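{- Consider an instance of \textsc{MFASS} with $K=2$ whose network has node set $\{s,v,t\}$, with every arc either going from $s$ to $v$ or from $v$ to $t$. Let $J^-=\delta^-(v)\cap J$ and $J^+=\delta^+(v)\cap J$, and suppose $\lvert J^-\rvert\leqslant\lvert J^+\rvert$. Write $J^-=\{a_1,\dots,a_r\}$ and $J^+=\{b_1,\dots,b_s\}$ (so $r\leqslant s$) with $u_{a_1}\geqslant u_{a_2}\geqslant\cdots\geqslant u_{a_r}$ and $u_{b_1}\geqslant u_{b_2}\geqslant\cdots\geqslant u_{b_s}$, and suppose the instance is feasible (equivalently $r+s\leqslant 2T$). Then the following schedule is optimal: (i) for $i=1,\dots,r$, arcs $a_i$ and $b_i$ are shut in period $i$; (ii) for $i=r+1,\dots,\min\{T,\,2T-s\}$, arc $b_i$ is shut in period $i$; (iii) if $s>T$, then for $i=2T-s+1,\dots,T$, arcs $b_i$ and $b_{2T+1-i}$ are shut in period $i$.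
   Context: A network $N=(V,A,s,t,u)$ consists of a finite node set $V$, a finite set $A$ of directed arcs (parallel arcs allowed), a source $s$, a sink $t$ and nonnegative integer capacities $u_a$; $\delta^-(v)$ and $\delta^+(v)$ denote the sets of arcs entering and leaving $v$. An instance of \textsc{MFASS} consists of a network $N$, a set $J\subseteq A$ of arcs (each needing one unit-duration maintenance job), a positive integer time horizon $T$ and a positive integer $K$. A feasible schedule assigns to every arc $a\in J$ exactly one period in $\{1,\dots,T\}$ (during which $a$ is shut, i.e. has capacity $0$) such that at most $K$ arcs are shut in each period; arcs not shut in a period have capacity $u_a$. The throughput of period $i$ is the maximum $s$–$t$ flow value with the period-$i$ capacities, and a schedule is optimal if it maximizes the total throughput over all periods among feasible schedules. (Here the letter $s$ is used both for the source and for $\lvert J^+\rvert$, as in the paper.) -}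

module Defs where

open import Data.Nat using (ℕ; zero; suc; _+_; _≤_; _<_)
open import Data.Integer using (ℤ; +_; _-_) renaming (_+_ to _+ℤ_; _≤_ to _≤ℤ_)
open import Data.Fin using (Fin; zero; suc; toℕ) renaming (_≟_ to _≟F_)
open import Data.Bool using (Bool; true; false; if_then_else_; _∧_)
open import Data.Product using (Σ; _×_; _,_)
open import Relation.Nullary using (¬_)
open import Relation.Nullary.Decidable using (⌊_⌋)
open import Relation.Binary.PropositionalEquality using (_≡_)
import Data.Nat as N

sumFin : ∀ {n} → (Fin n → ℕ) → ℕ
sumFin {zero}  f = 0
sumFin {suc n} f = f zero + sumFin (λ i → f (suc i))

sumPeriods : ℕ → (ℕ → ℤ) → ℤ
sumPeriods zero    g = + 0
sumPeriods (suc T) g = sumPeriods T g +ℤ g (suc T)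

record Network : Set where
  field
    n    : ℕ
    m    : ℕ
    tl   : Fin m → Fin n
    hd   : Fin m → Fin n
    s    : Fin n
    t    : Fin n
    u    : Fin m → ℕ

module _ (N : Network) where
  open Network N

  inflow : (Fin m → ℕ) → Fin n → ℕ
  inflow f w = sumFin (λ a → if ⌊ hd a ≟F w ⌋ then f a else 0)

  outflow : (Fin m → ℕ) → Fin n → ℕ
  outflow f w = sumFin (λ a → if ⌊ tl a ≟F w ⌋ then f a else 0)

  IsFlow : (Fin m → ℕ) → (Fin m → ℕ) → Set
  IsFlow cap f = (∀ a → f a ≤ cap a)
               × (∀ w → ¬ (w ≡ s) → ¬ (w ≡ t) → inflow f w ≡ outflow f w)

  value : (Fin m → ℕ) → ℤ
  value f = + outflow f s - + inflow f s

  -- A schedule assigns to each arc a period (a natural number); only the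
  -- values on arcs of J matter.
  shut : (Fin m → Bool) → (Fin m → ℕ) → ℕ → Fin m → Bool
  shut J σ p a = J a ∧ ⌊ σ a N.≟ p ⌋

  capAt : (Fin m → Bool) → (Fin m → ℕ) → ℕ → Fin m → ℕ
  capAt J σ p a = if shut J σ p a then 0 else u a

  numShut : (Fin m → Bool) → (Fin m → ℕ) → ℕ → ℕ
  numShut J σ p = sumFin (λ a → if shut J σ p a then 1 else 0)

  Feasible : (Fin m → Bool) → ℕ → ℕ → (Fin m → ℕ) → Set
  Feasible J T K σ = (∀ a → J a ≡ true → 1 ≤ σ a × σ a ≤ T)
                   × (∀ p → 1 ≤ p → p ≤ T → numShut J σ p ≤ K)

  PeriodFlows : (Fin m → Bool) → ℕ → (Fin m → ℕ) → (ℕ → Fin m → ℕ) → Set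
  PeriodFlows J T σ fs = ∀ p → 1 ≤ p → p ≤ T → IsFlow (capAt J σ p) (fs p)

  totalValue : ℕ → (ℕ → Fin m → ℕ) → ℤ
  totalValue T fs = sumPeriods T (λ p → value (fs p))

  -- σ is optimal: it is feasible, and there are flows for its periods whose
  -- total value is at least the total value of any flows for any feasible
  -- schedule (i.e. σ maximizes the sum of per-period maximum flow values).
  Optimal : (Fin m → Bool) → ℕ → ℕ → (Fin m → ℕ) → Set
  Optimal J T K σ =
    Feasible J T K σ
    × Σ (ℕ → Fin m → ℕ) (λ fs →
        PeriodFlows J T σ fs
        × (∀ (σ' : Fin m → ℕ) (fs' : ℕ → Fin m → ℕ) →
             Feasible J T K σ' → PeriodFlows J T σ' fs' →
             totalValue T fs' ≤ℤ totalValue T fs))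

nS nV nT : Fin 3
nS = zero
nV = suc zero
nT = suc (suc zero)

net3 : (m : ℕ) → (Fin m → Fin 3) → (Fin m → Fin 3) → (Fin m → ℕ) → Network
net3 m tl hd u = record { n = 3 ; m = m ; tl = tl ; hd = hd ; s = nS ; t = nT ; u = u }

-- In the network s → v → t, a period that shuts in-arcs of v of total capacity X and
-- out-arcs of total capacity Y has maximum flow min (A − X) (B − Y), where A and B are the
-- capacities into and out of v. Each job is shut exactly once, so the sum of X + Y over the
-- periods is the same for every feasible schedule, and it suffices to maximise the sum of
-- κ X Y = min (A + Y) (B + X). A feasible schedule is then a packing of the two lists of
-- capacities into T periods of at most two arcs each; padding with zero capacities makes every
-- period full. By induction on T, exchanging two arcs between periods never decreases the sum
-- and moves the largest remaining in-capacity next to the largest out-capacity or, when no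
-- in-capacity is left, the largest out-capacity next to the smallest: the greedy schedule.

module Submission where

open import Defs
open import Data.Nat using (ℕ; suc; _+_; _*_; _∸_; _⊓_; _≤_; _<_)
open import Data.Fin using (Fin; toℕ)
open import Data.Bool using (Bool; true)
open import Data.Product using (Σ; _×_)
open import Data.Sum using (_⊎_)
open import Relation.Binary.PropositionalEquality using (_≡_)

open import Data.Bool using (false; if_then_else_; _∧_; not)
open import Data.Empty using (⊥-elim)
open import Data.Fin using (zero; suc) renaming (_≟_ to _≟ᶠ_)
import Data.Fin.Properties as Fin
import Data.Integer as ℤ
open import Data.List
  using (List; []; _∷_; _++_; [_]; _∷ʳ_; length; map; concat; concatMap; applyUpTo; tabulate; replicate;
         initLast; _∷ʳ′_)
open import Data.List.Properties
  using (applyUpTo-∷ʳ; map-applyUpTo; length-applyUpTo; length-tabulate; length-++; ++-identityʳ;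
         length-replicate; length-++-≤ˡ)
import Data.List.Properties as List
open import Data.List.Membership.Propositional using (_∈_)
open import Data.List.Membership.Propositional.Properties using (∈-++⁻; ∈-∃++)
import Data.List.Relation.Binary.Permutation.Propositional as Perm
open Perm using (_↭_; ↭-refl; ↭-sym; ↭-trans; ↭-reflexive; prep; swap; module PermutationReasoning)
open import Data.List.Relation.Binary.Permutation.Propositional.Properties
  using (++⁺ˡ; ++⁺ʳ; shift; shifts; drop-∷; ∷↭∷ʳ; ↭-length; ↭-empty-inv; All-resp-↭; ∈-resp-↭; map⁺)
open import Data.List.Relation.Unary.All as All using (All; []; _∷_)
import Data.List.Relation.Unary.All.Properties as AllP
open import Data.List.Relation.Unary.AllPairs as AllPairs using (AllPairs; []; _∷_)
import Data.List.Relation.Unary.AllPairs.Properties as AllPairsP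
open import Data.List.Relation.Unary.Any using (here; there)
open import Data.Nat using (zero; _≥_; z≤n; s≤s)
open import Data.Nat.ListAction using (sum)
open import Data.Nat.ListAction.Properties using (sum-++; sum-↭)
open import Data.Nat.Properties
open import Algebra.Properties.CommutativeSemigroup +-commutativeSemigroup using (interchange)
open import Data.Nat.Tactic.RingSolver using (solve-∀)
open import Data.Product using (_,_; proj₁; proj₂)
open import Data.Sum using (inj₁; inj₂)
open import Function using (_∘_)
open import Relation.Binary.PropositionalEquality
  using (refl; sym; trans; cong; cong₂; subst; subst₂; _≢_; ≢-sym; module ≡-Reasoning)
open import Relation.Nullary using (yes; no)
open import Relation.Nullary.Decidable using (⌊_⌋; ⌊⌋-map′; isYes≗does)

2*n≡n+n : ∀ n → 2 * n ≡ n + n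
2*n≡n+n n = cong (n +_) (+-identityʳ n)

m∸n≡1+m∸1+n : ∀ {m n} → n < m → m ∸ n ≡ suc (m ∸ suc n)
m∸n≡1+m∸1+n = +-∸-assoc 1

≤-⊓-+-⊓ : ∀ {x p q r s} → x ≤ p + r → x ≤ p + s → x ≤ q + r → x ≤ q + s → x ≤ p ⊓ q + r ⊓ s
≤-⊓-+-⊓ {p = p} {q} {r} {s} pr ps qr qs with ⊓-sel p q | ⊓-sel r s
... | inj₁ p⊓q≡p | inj₁ r⊓s≡r rewrite p⊓q≡p | r⊓s≡r = pr
... | inj₁ p⊓q≡p | inj₂ r⊓s≡s rewrite p⊓q≡p | r⊓s≡s = ps
... | inj₂ p⊓q≡q | inj₁ r⊓s≡r rewrite p⊓q≡q | r⊓s≡r = qr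
... | inj₂ p⊓q≡q | inj₂ r⊓s≡s rewrite p⊓q≡q | r⊓s≡s = qs

-- ⌊_⌋ is stuck on the neutral decision m ≟ n, so this shift holds only propositionally.
⌊suc≟suc⌋ : ∀ m n → ⌊ suc m ≟ suc n ⌋ ≡ ⌊ m ≟ n ⌋
⌊suc≟suc⌋ m n = trans (isYes≗does (suc m ≟ suc n)) (sym (isYes≗does (m ≟ n)))

⌊≟⌋-false : ∀ {m n} → m ≢ n → ⌊ m ≟ n ⌋ ≡ false
⌊≟⌋-false {m} {n} m≢n with m ≟ n
... | yes m≡n = ⊥-elim (m≢n m≡n)
... | no  _   = refl

⌊≟⌋-⇔ : ∀ {m n m′ n′} → (m ≡ n → m′ ≡ n′) → (m′ ≡ n′ → m ≡ n) → ⌊ m ≟ n ⌋ ≡ ⌊ m′ ≟ n′ ⌋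
⌊≟⌋-⇔ {m} {n} {m′} {n′} to from with m ≟ n | m′ ≟ n′
... | yes _   | yes _    = refl
... | no  _   | no  _    = refl
... | yes m≡n | no  m′≢n′ = ⊥-elim (m′≢n′ (to m≡n))
... | no  m≢n | yes m′≡n′ = ⊥-elim (m≢n (from m′≡n′))

sumFin-cong : ∀ {n} {f g : Fin n → ℕ} → (∀ i → f i ≡ g i) → sumFin f ≡ sumFin g
sumFin-cong {zero}  f≡g = refl
sumFin-cong {suc n} f≡g = cong₂ _+_ (f≡g zero) (sumFin-cong (f≡g ∘ suc))

sumFin-mono : ∀ {n} {f g : Fin n → ℕ} → (∀ i → f i ≤ g i) → sumFin f ≤ sumFin g
sumFin-mono {zero}  f≤g = z≤n
sumFin-mono {suc n} f≤g = +-mono-≤ (f≤g zero) (sumFin-mono (f≤g ∘ suc))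

sumFin-+ : ∀ {n} (f g : Fin n → ℕ) → sumFin (λ i → f i + g i) ≡ sumFin f + sumFin g
sumFin-+ {zero}  f g = refl
sumFin-+ {suc n} f g = trans (cong (f zero + g zero +_) (sumFin-+ (f ∘ suc) (g ∘ suc)))
  (interchange (f zero) (g zero) (sumFin (f ∘ suc)) (sumFin (g ∘ suc)))

sumFin-zero : ∀ {n} {f : Fin n → ℕ} → (∀ i → f i ≡ 0) → sumFin f ≡ 0
sumFin-zero {zero}  f≡0 = refl
sumFin-zero {suc n} f≡0 rewrite f≡0 zero = sumFin-zero (f≡0 ∘ suc)

sumFin-point : ∀ {n} (j : Fin n) (g : Fin n → ℕ) →
  sumFin (λ i → if ⌊ i ≟ᶠ j ⌋ then g i else 0) ≡ g j
sumFin-point {suc n} zero g = trans (cong (g zero +_) (sumFin-zero {n} λ _ → refl)) (+-identityʳ (g zero))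
sumFin-point (suc j) g =
  trans (sumFin-cong λ i → cong (if_then g (suc i) else 0) (⌊⌋-map′ _ _ (i ≟ᶠ j))) (sumFin-point j (g ∘ suc))

sumFin-reindex : ∀ {m r} (a : Fin r → Fin m) (P : Fin m → Bool) →
  (∀ i j → a i ≡ a j → i ≡ j) → (∀ i → P (a i) ≡ true) →
  (∀ e → P e ≡ true → Σ (Fin r) (λ i → a i ≡ e)) → (g : Fin m → ℕ) →
  sumFin (λ e → if P e then g e else 0) ≡ sumFin (g ∘ a)
sumFin-reindex {r = zero} a P _ _ onto g = sumFin-zero outside
  where
  outside : ∀ e → (if P e then g e else 0) ≡ 0
  outside e with P e in Pe
  ... | true  with () ← onto e Pe
  ... | false = refl
sumFin-reindex {m} {suc r} a P inj inP onto g = begin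
  sumFin (λ e → if P e then g e else 0)
    ≡⟨ sumFin-cong split ⟩
  sumFin (λ e → (if ⌊ e ≟ᶠ a zero ⌋ then g e else 0) + (if P′ e then g e else 0))
    ≡⟨ sumFin-+ (λ e → if ⌊ e ≟ᶠ a zero ⌋ then g e else 0) (λ e → if P′ e then g e else 0) ⟩
  sumFin (λ e → if ⌊ e ≟ᶠ a zero ⌋ then g e else 0) + sumFin (λ e → if P′ e then g e else 0)
    ≡⟨ cong₂ _+_ (sumFin-point (a zero) g) (sumFin-reindex (a ∘ suc) P′ inj′ inP′ onto′ g) ⟩
  g (a zero) + sumFin (g ∘ a ∘ suc) ∎
  where
  open ≡-Reasoning
  P′ : Fin m → Bool
  P′ e = P e ∧ not ⌊ e ≟ᶠ a zero ⌋
  split : ∀ e → (if P e then g e else 0) ≡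
                (if ⌊ e ≟ᶠ a zero ⌋ then g e else 0) + (if P′ e then g e else 0)
  split e with e ≟ᶠ a zero
  ... | yes refl rewrite inP zero = sym (+-identityʳ _)
  ... | no _ with P e
  ...   | true  = refl
  ...   | false = refl
  inj′ : ∀ i j → a (suc i) ≡ a (suc j) → i ≡ j
  inj′ i j eq = Fin.suc-injective (inj (suc i) (suc j) eq)
  inP′ : ∀ i → P′ (a (suc i)) ≡ true
  inP′ i rewrite inP (suc i) with a (suc i) ≟ᶠ a zero
  ... | yes eq with () ← inj (suc i) zero eq
  ... | no _ = refl
  onto′ : ∀ e → P′ e ≡ true → Σ (Fin r) (λ i → a (suc i) ≡ e)
  onto′ e P′e with P e in Pe | e ≟ᶠ a zero
  onto′ e ()  | false | _
  onto′ e ()  | true  | yes _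
  onto′ e _   | true  | no e≢a₀ with onto e Pe
  ... | zero  , eq = ⊥-elim (e≢a₀ (sym eq))
  ... | suc i , eq = i , eq

distribute : ∀ {n} (c : Fin n → ℕ) (F : ℕ) → F ≤ sumFin c →
  Σ (Fin n → ℕ) λ g → (∀ e → g e ≤ c e) × sumFin g ≡ F
distribute {zero} c zero _ = (λ ()) , (λ ()) , refl
distribute {suc n} c F F≤ with distribute (c ∘ suc) (F ∸ c zero ⊓ F) rest≤
  where
  rest≤ : F ∸ c zero ⊓ F ≤ sumFin (c ∘ suc)
  rest≤ with ≤-total (c zero) F
  ... | inj₁ c₀≤F rewrite m≤n⇒m⊓n≡m c₀≤F = m≤n+o⇒m∸n≤o F (c zero) F≤
  ... | inj₂ F≤c₀ rewrite m≥n⇒m⊓n≡n F≤c₀ | n∸n≡0 F = z≤n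
... | g , g≤c , Σg≡ = g′ , g′≤c , trans (cong (c zero ⊓ F +_) Σg≡) (m+[n∸m]≡n (m⊓n≤n (c zero) F))
  where
  g′ : Fin (suc n) → ℕ
  g′ zero    = c zero ⊓ F
  g′ (suc e) = g e
  g′≤c : ∀ e → g′ e ≤ c e
  g′≤c zero    = m⊓n≤m _ _
  g′≤c (suc e) = g≤c e

-- nth xs q is the entry of xs at position q, and 0 beyond the end of xs.
nth : List ℕ → ℕ → ℕ
nth []       _       = 0
nth (x ∷ xs) zero    = x
nth (x ∷ xs) (suc q) = nth xs q

nth-beyond : ∀ xs q → length xs ≤ q → nth xs q ≡ 0
nth-beyond []       q       _         = refl
nth-beyond (x ∷ xs) (suc q) (s≤s len≤q) = nth-beyond xs q len≤q

nth-++ˡ : ∀ xs ys q → q < length xs → nth (xs ++ ys) q ≡ nth xs q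
nth-++ˡ (x ∷ xs) ys zero    _         = refl
nth-++ˡ (x ∷ xs) ys (suc q) (s≤s q<len) = nth-++ˡ xs ys q q<len

nth-∷ʳ : ∀ xs y → nth (xs ∷ʳ y) (length xs) ≡ y
nth-∷ʳ []       y = refl
nth-∷ʳ (x ∷ xs) y = nth-∷ʳ xs y

nth-++-zeros : ∀ xs d q → nth (xs ++ replicate d 0) q ≡ nth xs q
nth-++-zeros []       d       q       = zeros d q
  where
  zeros : ∀ d q → nth (replicate d 0) q ≡ 0
  zeros zero    q       = refl
  zeros (suc d) zero    = refl
  zeros (suc d) (suc q) = zeros d q
nth-++-zeros (x ∷ xs) d zero    = refl
nth-++-zeros (x ∷ xs) d (suc q) = nth-++-zeros xs d q

nth-≤ : ∀ {c} xs q → All (_≤ c) xs → nth xs q ≤ c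
nth-≤ []       q       _          = z≤n
nth-≤ (x ∷ xs) zero    (x≤c ∷ _)  = x≤c
nth-≤ (x ∷ xs) (suc q) (_ ∷ xs≤c) = nth-≤ xs q xs≤c

sumFin-select : ∀ {n} (v : Fin n → ℕ) q →
  sumFin (λ i → if ⌊ toℕ i ≟ q ⌋ then v i else 0) ≡ nth (tabulate v) q
sumFin-select {zero}  v q       = refl
sumFin-select {suc n} v zero    = trans (cong (v zero +_) (sumFin-zero {n} λ _ → refl)) (+-identityʳ _)
sumFin-select {suc n} v (suc q) =
  trans (sumFin-cong λ i → cong (if_then v (suc i) else 0) (⌊suc≟suc⌋ (toℕ i) q))
        (sumFin-select (v ∘ suc) q)

sum≤-length≤1 : ∀ {β} (xs : List ℕ) → length xs ≤ 1 → All (_≤ β) xs → sum xs ≤ β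
sum≤-length≤1 []       _ _           = z≤n
sum≤-length≤1 (x ∷ []) _ (x≤β ∷ []) = ≤-trans (≤-reflexive (+-identityʳ x)) x≤β
sum≤-length≤1 (_ ∷ _ ∷ _) (s≤s ()) _

sum-concat : ∀ xss → sum (concat xss) ≡ sum (map sum xss)
sum-concat []         = refl
sum-concat (xs ∷ xss) = trans (sum-++ xs (concat xss)) (cong (sum xs +_) (sum-concat xss))

∈-extract : ∀ {x : ℕ} {xs} → x ∈ xs → Σ (List ℕ) λ ys → xs ↭ x ∷ ys
∈-extract {x} x∈xs with ys , zs , refl ← ∈-∃++ x∈xs = ys ++ zs , shift x ys zs

++-cancelˡ-↭ : ∀ (xs : List ℕ) {ys zs} → xs ++ ys ↭ xs ++ zs → ys ↭ zs
++-cancelˡ-↭ []       p = p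
++-cancelˡ-↭ (x ∷ xs) p = ++-cancelˡ-↭ xs (drop-∷ p)

applyUpTo-cong : ∀ {A : Set} {f g : ℕ → A} n → (∀ q → q < n → f q ≡ g q) →
  applyUpTo f n ≡ applyUpTo g n
applyUpTo-cong zero    f≡g = refl
applyUpTo-cong (suc n) f≡g =
  cong₂ _∷_ (f≡g 0 (s≤s z≤n)) (applyUpTo-cong n λ q q<n → f≡g (suc q) (s≤s q<n))

concat-applyUpTo-[] : ∀ {A : Set} n → concat (applyUpTo {A = List A} (λ _ → []) n) ≡ []
concat-applyUpTo-[] zero    = refl
concat-applyUpTo-[] (suc n) = concat-applyUpTo-[] n

sum-applyUpTo-mono : ∀ {f g : ℕ → ℕ} n → (∀ q → q < n → f q ≤ g q) →
  sum (applyUpTo f n) ≤ sum (applyUpTo g n)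
sum-applyUpTo-mono zero    f≤g = z≤n
sum-applyUpTo-mono (suc n) f≤g =
  +-mono-≤ (f≤g 0 (s≤s z≤n)) (sum-applyUpTo-mono n λ q q<n → f≤g (suc q) (s≤s q<n))

sum-applyUpTo-+ : ∀ (f g : ℕ → ℕ) n →
  sum (applyUpTo (λ q → f q + g q) n) ≡ sum (applyUpTo f n) + sum (applyUpTo g n)
sum-applyUpTo-+ f g zero    = refl
sum-applyUpTo-+ f g (suc n) =
  trans (cong (f 0 + g 0 +_) (sum-applyUpTo-+ (f ∘ suc) (g ∘ suc) n))
        (interchange (f 0) (g 0) (sum (applyUpTo (f ∘ suc) n)) (sum (applyUpTo (g ∘ suc) n)))

sumPeriods-+ : ∀ T (F : ℕ → ℕ) → sumPeriods T (λ p → ℤ.+ F p) ≡ ℤ.+ sum (applyUpTo (F ∘ suc) T)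
sumPeriods-+ zero    F = refl
sumPeriods-+ (suc T) F = begin
  sumPeriods T (λ p → ℤ.+ F p) ℤ.+ ℤ.+ F (suc T)   ≡⟨ cong (ℤ._+ ℤ.+ F (suc T)) (sumPeriods-+ T F) ⟩
  ℤ.+ (sum xs + F (suc T))                         ≡⟨ cong ℤ.+_ last ⟩
  ℤ.+ sum (xs ∷ʳ F (suc T))                        ≡⟨ cong (ℤ.+_ ∘ sum) (applyUpTo-∷ʳ (F ∘ suc) T) ⟩
  ℤ.+ sum (applyUpTo (F ∘ suc) (suc T))            ∎
  where
  open ≡-Reasoning
  xs : List ℕ
  xs = applyUpTo (F ∘ suc) T
  last : sum xs + F (suc T) ≡ sum (xs ∷ʳ F (suc T))
  last = sym (trans (sum-++ xs [ F (suc T) ]) (cong (sum xs +_) (+-identityʳ _)))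

sumPeriods-cong : ∀ T {g h : ℕ → ℤ.ℤ} → (∀ p → g p ≡ h p) → sumPeriods T g ≡ sumPeriods T h
sumPeriods-cong zero    g≡h = refl
sumPeriods-cong (suc T) g≡h = cong₂ ℤ._+_ (sumPeriods-cong T g≡h) (g≡h (suc T))

fibre : ∀ {n} → (Fin n → ℕ) → (Fin n → ℕ) → ℕ → List ℕ
fibre {zero}  key val p = []
fibre {suc n} key val p = if ⌊ key zero ≟ p ⌋
  then val zero ∷ fibre (key ∘ suc) (val ∘ suc) p
  else fibre (key ∘ suc) (val ∘ suc) p

sum-fibre : ∀ {n} (key val : Fin n → ℕ) p →
  sum (fibre key val p) ≡ sumFin (λ i → if ⌊ key i ≟ p ⌋ then val i else 0)
sum-fibre {zero}  key val p = refl
sum-fibre {suc n} key val p with ⌊ key zero ≟ p ⌋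
... | true  = cong (val zero +_) (sum-fibre (key ∘ suc) (val ∘ suc) p)
... | false = sum-fibre (key ∘ suc) (val ∘ suc) p

length-fibre : ∀ {n} (key val : Fin n → ℕ) p →
  length (fibre key val p) ≡ sumFin (λ i → if ⌊ key i ≟ p ⌋ then 1 else 0)
length-fibre {zero}  key val p = refl
length-fibre {suc n} key val p with ⌊ key zero ≟ p ⌋
... | true  = cong suc (length-fibre (key ∘ suc) (val ∘ suc) p)
... | false = length-fibre (key ∘ suc) (val ∘ suc) p

fibre-∉ : ∀ {n} (key val : Fin n → ℕ) p → (∀ i → key i ≢ p) → fibre key val p ≡ []
fibre-∉ {zero}  key val p _    = refl
fibre-∉ {suc n} key val p ≢p with key zero ≟ p
... | yes eq = ⊥-elim (≢p zero eq)
... | no  _  = fibre-∉ (key ∘ suc) (val ∘ suc) p (≢p ∘ suc)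

concat-insert : ∀ n (F : ℕ → List ℕ) q x → q < n →
  concat (applyUpTo (λ p → if ⌊ q ≟ p ⌋ then x ∷ F p else F p) n) ↭ x ∷ concat (applyUpTo F n)
concat-insert (suc n) F zero    x _         = ↭-refl
concat-insert (suc n) F (suc q) x (s≤s q<n) =
  ↭-trans (++⁺ˡ (F 0) (↭-trans (↭-reflexive (cong concat shifted))
                                (concat-insert n (F ∘ suc) q x q<n)))
          (shift x (F 0) _)
  where
  shifted : applyUpTo (λ p → if ⌊ suc q ≟ suc p ⌋ then x ∷ F (suc p) else F (suc p)) n
          ≡ applyUpTo (λ p → if ⌊ q ≟ p ⌋ then x ∷ F (suc p) else F (suc p)) n
  shifted = applyUpTo-cong n λ p _ →
    cong (if_then x ∷ F (suc p) else F (suc p)) (⌊suc≟suc⌋ q p)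

concat-fibres : ∀ {m} n (key val : Fin m → ℕ) → (∀ i → key i < n) →
  concat (applyUpTo (fibre key val) n) ↭ tabulate val
concat-fibres {zero}  n key val _     = ↭-reflexive (concat-applyUpTo-[] n)
concat-fibres {suc m} n key val key<n =
  ↭-trans (concat-insert n (fibre (key ∘ suc) (val ∘ suc)) (key zero) (val zero) (key<n zero))
          (prep (val zero) (concat-fibres n (key ∘ suc) (val ∘ suc) (key<n ∘ suc)))

concat-fibres-from-1 : ∀ {m} T (key val : Fin m → ℕ) → (∀ i → 1 ≤ key i × key i ≤ T) →
  concat (applyUpTo (fibre key val ∘ suc) T) ↭ tabulate val
concat-fibres-from-1 T key val key∈ =
  subst (_↭ tabulate val) (cong (_++ concat (applyUpTo (fibre key val ∘ suc) T)) (fibre-∉ key val 0 key≢0))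
        (concat-fibres (suc T) key val (λ i → s≤s (proj₂ (key∈ i))))
  where
  key≢0 : ∀ i → key i ≢ 0
  key≢0 i key≡0 = <⇒≢ (proj₁ (key∈ i)) (sym key≡0)

sum-periods-fibres : ∀ {m} T (key val : Fin m → ℕ) → (∀ i → 1 ≤ key i × key i ≤ T) →
  sum (applyUpTo (λ q → sumFin (λ i → if ⌊ key i ≟ suc q ⌋ then val i else 0)) T) ≡ sum (tabulate val)
sum-periods-fibres T key val key∈ = begin
  sum (applyUpTo (λ q → sumFin (λ i → if ⌊ key i ≟ suc q ⌋ then val i else 0)) T)
    ≡⟨ cong sum (applyUpTo-cong T λ q _ → sum-fibre key val (suc q)) ⟨
  sum (applyUpTo (sum ∘ fibre key val ∘ suc) T)
    ≡⟨ cong sum (map-applyUpTo (fibre key val ∘ suc) sum T) ⟨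
  sum (map sum (applyUpTo (fibre key val ∘ suc) T))
    ≡⟨ sum-concat (applyUpTo (fibre key val ∘ suc) T) ⟨
  sum (concat (applyUpTo (fibre key val ∘ suc) T))
    ≡⟨ sum-↭ (concat-fibres-from-1 T key val key∈) ⟩
  sum (tabulate val) ∎
  where open ≡-Reasoning

-- The three-node network

module ThreeNode (m : ℕ) (tl hd : Fin m → Fin 3) (u : Fin m → ℕ)
  (arcs : ∀ e → (tl e ≡ nS × hd e ≡ nV) ⊎ (tl e ≡ nV × hd e ≡ nT)) where

  N : Network
  N = net3 m tl hd u

  throughput : (Fin m → ℕ) → ℕ
  throughput cap = inflow N cap nV ⊓ outflow N cap nV

  value≡inflow : ∀ f → value N f ≡ ℤ.+ inflow N f nV
  value≡inflow f =
    trans (cong₂ (λ o i → ℤ.+ o ℤ.- ℤ.+ i) outflow≡inflow inflow≡0) (cong ℤ.+_ (+-identityʳ _))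
    where
    inflow≡0 : inflow N f nS ≡ 0
    inflow≡0 = sumFin-zero λ e → case e
      where
      case : ∀ e → (if ⌊ hd e ≟ᶠ nS ⌋ then f e else 0) ≡ 0
      case e with arcs e
      ... | inj₁ (_ , hd≡) rewrite hd≡ = refl
      ... | inj₂ (_ , hd≡) rewrite hd≡ = refl
    outflow≡inflow : outflow N f nS ≡ inflow N f nV
    outflow≡inflow = sumFin-cong case
      where
      case : ∀ e → (if ⌊ tl e ≟ᶠ nS ⌋ then f e else 0) ≡ (if ⌊ hd e ≟ᶠ nV ⌋ then f e else 0)
      case e with arcs e
      ... | inj₁ (tl≡ , hd≡) rewrite tl≡ | hd≡ = refl
      ... | inj₂ (tl≡ , hd≡) rewrite tl≡ | hd≡ = refl

  flow≤throughput : ∀ cap f → IsFlow N cap f → inflow N f nV ≤ throughput cap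
  flow≤throughput cap f (f≤cap , conserve) =
    ⊓-glb (sumFin-mono (restrict hd))
          (subst (_≤ outflow N cap nV) (sym (conserve nV (λ ()) (λ ()))) (sumFin-mono (restrict tl)))
    where
    restrict : ∀ (end : Fin m → Fin 3) e →
      (if ⌊ end e ≟ᶠ nV ⌋ then f e else 0) ≤ (if ⌊ end e ≟ᶠ nV ⌋ then cap e else 0)
    restrict end e with ⌊ end e ≟ᶠ nV ⌋
    ... | true  = f≤cap e
    ... | false = z≤n

  -- Route min(in, out) into v and the same amount out of v, each below the capacities.
  maxFlow : ∀ cap → Σ (Fin m → ℕ) λ f → IsFlow N cap f × inflow N f nV ≡ throughput cap
  maxFlow cap with distribute cap-in (throughput cap) (m⊓n≤m _ _)
                 | distribute cap-out (throughput cap) (m⊓n≤n _ _)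
    where
    cap-in cap-out : Fin m → ℕ
    cap-in  e = if ⌊ hd e ≟ᶠ nV ⌋ then cap e else 0
    cap-out e = if ⌊ tl e ≟ᶠ nV ⌋ then cap e else 0
  ... | g-in , g-in≤ , Σg-in | g-out , g-out≤ , Σg-out = f , (f≤cap , conserve) , in≡
    where
    f : Fin m → ℕ
    f e = if ⌊ hd e ≟ᶠ nV ⌋ then g-in e else g-out e
    f≤cap : ∀ e → f e ≤ cap e
    f≤cap e with ⌊ hd e ≟ᶠ nV ⌋ | g-in≤ e | ⌊ tl e ≟ᶠ nV ⌋ | g-out≤ e
    ... | true  | ≤cap | _     | _    = ≤cap
    ... | false | _    | true  | ≤cap = ≤cap
    ... | false | _    | false | ≤0   = ≤-trans ≤0 z≤n
    in≡ : inflow N f nV ≡ throughput cap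
    in≡ = trans (sumFin-cong case) Σg-in
      where
      case : ∀ e → (if ⌊ hd e ≟ᶠ nV ⌋ then f e else 0) ≡ g-in e
      case e with ⌊ hd e ≟ᶠ nV ⌋ | g-in≤ e
      ... | true  | _  = refl
      ... | false | ≤0 = sym (n≤0⇒n≡0 ≤0)
    out≡ : outflow N f nV ≡ throughput cap
    out≡ = trans (sumFin-cong case) Σg-out
      where
      case : ∀ e → (if ⌊ tl e ≟ᶠ nV ⌋ then f e else 0) ≡ g-out e
      case e with arcs e | g-out≤ e
      ... | inj₁ (tl≡ , _)   | ≤0 rewrite tl≡ = sym (n≤0⇒n≡0 ≤0)
      ... | inj₂ (tl≡ , hd≡) | _  rewrite tl≡ | hd≡ = refl
    conserve : ∀ w → w ≢ nS → w ≢ nT → inflow N f w ≡ outflow N f w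
    conserve zero             w≢s _   = ⊥-elim (w≢s refl)
    conserve (suc zero)       _   _   = trans in≡ (sym out≡)
    conserve (suc (suc zero)) _   w≢t = ⊥-elim (w≢t refl)

  weight : (Fin m → Bool) → ℕ → (Fin m → ℕ) → ℕ
  weight J T τ = sum (applyUpTo (λ q → throughput (capAt N J τ (suc q))) T)

  totalValue≡ : ∀ T fs → totalValue N T fs ≡ ℤ.+ sum (applyUpTo (λ q → inflow N (fs (suc q)) nV) T)
  totalValue≡ T fs = trans (sumPeriods-cong T (value≡inflow ∘ fs)) (sumPeriods-+ T (λ p → inflow N (fs p) nV))

  maximal⇒optimal : ∀ {J T K σ} → Feasible N J T K σ →
    (∀ τ → Feasible N J T K τ → weight J T τ ≤ weight J T σ) → Optimal N J T K σ
  maximal⇒optimal {J} {T} {K} {σ} σ-feasible maximal = σ-feasible , fs , fs-flows , bound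
    where
    fs : ℕ → Fin m → ℕ
    fs p = proj₁ (maxFlow (capAt N J σ p))
    fs-flows : PeriodFlows N J T σ fs
    fs-flows p _ _ = proj₁ (proj₂ (maxFlow (capAt N J σ p)))
    total≡ : totalValue N T fs ≡ ℤ.+ weight J T σ
    total≡ = trans (totalValue≡ T fs)
      (cong (ℤ.+_ ∘ sum) (applyUpTo-cong T λ q _ → proj₂ (proj₂ (maxFlow (capAt N J σ (suc q))))))
    bound : ∀ τ fs′ → Feasible N J T K τ → PeriodFlows N J T τ fs′ → totalValue N T fs′ ℤ.≤ totalValue N T fs
    bound τ fs′ τ-feasible fs′-flows rewrite totalValue≡ T fs′ | total≡ =
      ℤ.+≤+ (≤-trans (sum-applyUpTo-mono T λ q q<T → flow≤throughput _ _ (fs′-flows (suc q) (s≤s z≤n) q<T))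
                   (maximal τ τ-feasible))

Descending : List ℕ → Set
Descending = AllPairs _≥_

Descending-head : ∀ {x xs} → Descending (x ∷ xs) → All (_≤ x) (x ∷ xs)
Descending-head (x≥xs ∷ _) = ≤-refl ∷ x≥xs

Descending-∷ʳ⁻ : ∀ xs {y} → Descending (xs ∷ʳ y) → Descending xs
Descending-∷ʳ⁻ []       _               = []
Descending-∷ʳ⁻ (x ∷ xs) (x≥xs∷ʳy ∷ desc) = AllP.++⁻ˡ xs x≥xs∷ʳy ∷ Descending-∷ʳ⁻ xs desc

Descending-last : ∀ xs {y} → Descending (xs ∷ʳ y) → All (y ≤_) (xs ∷ʳ y)
Descending-last []       _               = ≤-refl ∷ []
Descending-last (x ∷ xs) (x≥xs∷ʳy ∷ desc) with AllP.++⁻ʳ xs x≥xs∷ʳy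
... | y≤x ∷ [] = y≤x ∷ Descending-last xs desc

Descending-++-zeros : ∀ {xs} d → Descending xs → Descending (xs ++ replicate d 0)
Descending-++-zeros {xs} d desc =
  AllPairsP.++⁺ desc (zeros d) (All.tabulate λ _ → AllP.replicate⁺ d z≤n)
  where
  zeros : ∀ d → Descending (replicate d 0)
  zeros zero    = []
  zeros (suc d) = AllP.replicate⁺ d z≤n ∷ zeros d

tabulate-descending : ∀ {n} {f : Fin n → ℕ} → (∀ i j → toℕ i ≤ toℕ j → f j ≤ f i) → Descending (tabulate f)
tabulate-descending f-sorted = AllPairsP.tabulate⁺-< λ {i} {j} i<j → f-sorted i j (<⇒≤ i<j)

-- Packings of capacities into periods

Block : Set
Block = List ℕ × List ℕ

size : Block → ℕ
size (xs , ys) = length xs + length ys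

concatMap-↭ : ∀ (f : Block → List ℕ) {P Q} → P ↭ Q → concatMap f P ↭ concatMap f Q
concatMap-↭ f Perm.refl          = ↭-refl
concatMap-↭ f (prep b p)         = ++⁺ˡ (f b) (concatMap-↭ f p)
concatMap-↭ f (swap b c p)       = ↭-trans (shifts (f b) (f c)) (++⁺ˡ (f c) (++⁺ˡ (f b) (concatMap-↭ f p)))
concatMap-↭ f (Perm.trans p q)   = ↭-trans (concatMap-↭ f p) (concatMap-↭ f q)

block-extract : ∀ (f : Block → List ℕ) {x} P → x ∈ concatMap f P →
  Σ Block λ b → Σ (List Block) λ P₁ → Σ (List ℕ) λ xs → P ↭ b ∷ P₁ × f b ↭ x ∷ xs
block-extract f (b ∷ P) x∈ with ∈-++⁻ (f b) x∈
... | inj₁ x∈b with xs , b↭ ← ∈-extract x∈b = b , P , xs , ↭-refl , b↭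
... | inj₂ x∈P with c , P₁ , xs , P↭ , c↭ ← block-extract f P x∈P =
  c , b ∷ P₁ , xs , ↭-trans (prep b P↭) (swap b c ↭-refl) , c↭

-- P lists, period by period, the capacities shut into v and out of v.
record IsPacking (as bs : List ℕ) (T : ℕ) (P : List Block) : Set where
  field
    length≡ : length P ≡ T
    small   : All (λ b → size b ≤ 2) P
    ins     : concatMap proj₁ P ↭ as
    outs    : concatMap proj₂ P ↭ bs

IsPacking-↭ : ∀ {as as′ bs bs′ T P} → as ↭ as′ → bs ↭ bs′ → IsPacking as bs T P → IsPacking as′ bs′ T P
IsPacking-↭ as↭ bs↭ pk = record
  { length≡ = length≡ ; small = small ; ins = ↭-trans ins as↭ ; outs = ↭-trans outs bs↭ }
  where open IsPacking pk

IsPacking-tail : ∀ {xs ys as bs T P b P₁} → IsPacking (xs ++ as) (ys ++ bs) (suc T) P →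
  P ↭ b ∷ P₁ → proj₁ b ↭ xs → proj₂ b ↭ ys → IsPacking as bs T P₁
IsPacking-tail {xs} {ys} {b = b} {P₁} pk P↭ b↭xs b↭ys = record
  { length≡ = suc-injective (trans (sym (↭-length P↭)) length≡)
  ; small   = All.tail (All-resp-↭ P↭ small)
  ; ins     = ++-cancelˡ-↭ xs (↭-trans (++⁺ʳ _ (↭-sym b↭xs)) (↭-trans (↭-sym (concatMap-↭ proj₁ P↭)) ins))
  ; outs    = ++-cancelˡ-↭ ys (↭-trans (++⁺ʳ _ (↭-sym b↭ys)) (↭-trans (↭-sym (concatMap-↭ proj₂ P↭)) outs))
  }
  where open IsPacking pk

IsPacking-merge : ∀ {xs ys as bs T P b₁ b₂ P₂} c → IsPacking (xs ++ as) (ys ++ bs) (suc T) P →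
  P ↭ b₁ ∷ b₂ ∷ P₂ → size c ≤ 2 →
  proj₁ b₁ ++ proj₁ b₂ ↭ xs ++ proj₁ c → proj₂ b₁ ++ proj₂ b₂ ↭ ys ++ proj₂ c →
  IsPacking as bs T (c ∷ P₂)
IsPacking-merge {xs} {ys} {P = P} {b₁} {b₂} {P₂} c pk P↭ size≤2 ↭xs ↭ys = record
  { length≡ = suc-injective (trans (sym (↭-length P↭)) length≡)
  ; small   = size≤2 ∷ All.tail (All.tail (All-resp-↭ P↭ small))
  ; ins     = ++-cancelˡ-↭ xs (regroup proj₁ ↭xs ins)
  ; outs    = ++-cancelˡ-↭ ys (regroup proj₂ ↭ys outs)
  }
  where
  open IsPacking pk
  open PermutationReasoning
  regroup : ∀ (f : Block → List ℕ) {zs cs} → f b₁ ++ f b₂ ↭ zs ++ f c → concatMap f P ↭ cs →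
    zs ++ (f c ++ concatMap f P₂) ↭ cs
  regroup f {zs} {cs} ↭zs P↭cs = begin
    zs ++ (f c ++ concatMap f P₂)       ≡⟨ List.++-assoc zs (f c) _ ⟨
    (zs ++ f c) ++ concatMap f P₂       ↭⟨ ++⁺ʳ _ ↭zs ⟨
    (f b₁ ++ f b₂) ++ concatMap f P₂    ≡⟨ List.++-assoc (f b₁) (f b₂) _ ⟩
    concatMap f (b₁ ∷ b₂ ∷ P₂)          ↭⟨ concatMap-↭ f P↭ ⟨
    concatMap f P                       ↭⟨ P↭cs ⟩
    cs                                  ∎

total-size : ∀ P → length (concatMap proj₁ P) + length (concatMap proj₂ P) ≡ sum (map size P)
total-size [] = refl
total-size ((xs , ys) ∷ P) = begin
  length (xs ++ concatMap proj₁ P) + length (ys ++ concatMap proj₂ P)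
    ≡⟨ cong₂ _+_ (length-++ xs) (length-++ ys) ⟩
  (length xs + length (concatMap proj₁ P)) + (length ys + length (concatMap proj₂ P))
    ≡⟨ interchange (length xs) _ (length ys) _ ⟩
  size (xs , ys) + (length (concatMap proj₁ P) + length (concatMap proj₂ P))
    ≡⟨ cong (size (xs , ys) +_) (total-size P) ⟩
  sum (map size (((xs , ys) ∷ P))) ∎
  where open ≡-Reasoning

packing-size : ∀ {as bs T P} → IsPacking as bs T P → length as + length bs ≡ sum (map size P)
packing-size {P = P} pk =
  trans (cong₂ _+_ (sym (↭-length ins)) (sym (↭-length outs))) (total-size P)
  where open IsPacking pk

sum-size≤ : ∀ {P} → All (λ b → size b ≤ 2) P → sum (map size P) ≤ length P + length P
sum-size≤ []             = z≤n
sum-size≤ {_ ∷ P} (s ∷ ss) =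
  ≤-trans (+-mono-≤ s (sum-size≤ ss)) (≤-reflexive (cong suc (sym (+-suc (length P) (length P)))))

packing-count : ∀ {as bs T P} → IsPacking as bs T P → length as + length bs ≤ T + T
packing-count {T = T} pk rewrite packing-size pk | sym (IsPacking.length≡ pk) = sum-size≤ (IsPacking.small pk)

small-block : ∀ P → All (λ b → size b ≤ 2) P → sum (map size P) < length P + length P →
  Σ Block λ b → Σ (List Block) λ P₁ → P ↭ b ∷ P₁ × size b ≤ 1
small-block (b ∷ P) (s ∷ ss) count< with size b ≤? 1
... | yes s≤1 = b , P , ↭-refl , s≤1
... | no  s≰1 with small-block P ss
                    (drop-pair (subst (λ n → n + sum (map size P) < length (b ∷ P) + length (b ∷ P)) size≡2 count<))
  where
  size≡2 : size b ≡ 2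
  size≡2 = ≤-antisym s (≰⇒> s≰1)
  drop-pair : ∀ {m n} → 2 + m < suc n + suc n → m < n + n
  drop-pair {m} {n} h = ≤-pred (subst (suc (suc m) ≤_) (+-suc n n) (≤-pred h))
... | c , P₁ , P↭ , c≤1 = c , b ∷ P₁ , ↭-trans (prep b P↭) (swap b c ↭-refl) , c≤1

pair-block : ∀ {xs ys : List ℕ} {x y} xs′ ys′ → size (xs , ys) ≤ 2 → xs ↭ x ∷ xs′ → ys ↭ y ∷ ys′ →
  xs′ ≡ [] × ys′ ≡ []
pair-block xs′ ys′ size≤2 xs↭ ys↭ with subst₂ (λ m n → m + n ≤ 2) (↭-length xs↭) (↭-length ys↭) size≤2
pair-block []      []      _ _ _ | _ = refl , refl
pair-block []      (_ ∷ _) _ _ _ | s≤s (s≤s ())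
pair-block (_ ∷ r) ys′     _ _ _ | s≤s (s≤s r+ys≤0) with () ← m+n≤o⇒n≤o (length r) r+ys≤0

no-ins : ∀ {P b P₁} → concatMap proj₁ P ↭ [] → P ↭ b ∷ P₁ → proj₁ b ≡ [] × concatMap proj₁ P₁ ≡ []
no-ins {b = b} {P₁} P↭[] P↭ = List.++-conicalˡ (proj₁ b) _ empty , List.++-conicalʳ (proj₁ b) _ empty
  where
  empty : proj₁ b ++ concatMap proj₁ P₁ ≡ []
  empty = ↭-empty-inv (↭-trans (↭-sym (concatMap-↭ proj₁ P↭)) P↭[])

-- The exchange argument

module Exchange (A B : ℕ) where

  κ : ℕ → ℕ → ℕ
  κ X Y = (A + Y) ⊓ (B + X)

  κ≤in : ∀ X Y → κ X Y ≤ A + Y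
  κ≤in X Y = m⊓n≤m (A + Y) (B + X)

  κ≤out : ∀ X Y → κ X Y ≤ B + X
  κ≤out X Y = m⊓n≤n (A + Y) (B + X)

  κ-exchange : ∀ α β x₁ y₁ x₂ y₂ → y₁ ≤ β + x₁ → x₂ ≤ α + y₂ →
    κ (α + x₁) y₁ + κ x₂ (β + y₂) ≤ κ α β + κ (x₁ + x₂) (y₁ + y₂)
  κ-exchange α β x₁ y₁ x₂ y₂ y₁≤ x₂≤ = ≤-⊓-+-⊓ {p = A + β} {B + α} {A + (y₁ + y₂)} {B + (x₁ + x₂)}
    (≤-trans (+-mono-≤ (κ≤in (α + x₁) y₁) (κ≤in x₂ (β + y₂))) (≤-reflexive (e₁ A β y₁ y₂)))
    (≤-trans (+-mono-≤ (κ≤in (α + x₁) y₁) (κ≤out x₂ (β + y₂)))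
      (≤-trans (+-monoˡ-≤ (B + x₂) (+-monoʳ-≤ A y₁≤)) (≤-reflexive (e₂ A B β x₁ x₂))))
    (≤-trans (+-mono-≤ (κ≤in (α + x₁) y₁) (κ≤out x₂ (β + y₂)))
      (≤-trans (+-monoʳ-≤ (A + y₁) (+-monoʳ-≤ B x₂≤)) (≤-reflexive (e₃ A B α y₁ y₂))))
    (≤-trans (+-mono-≤ (κ≤out (α + x₁) y₁) (κ≤out x₂ (β + y₂))) (≤-reflexive (e₄ B α x₁ x₂)))
    where
    e₁ : ∀ A β y₁ y₂ → (A + y₁) + (A + (β + y₂)) ≡ (A + β) + (A + (y₁ + y₂))
    e₁ = solve-∀
    e₂ : ∀ A B β x₁ x₂ → (A + (β + x₁)) + (B + x₂) ≡ (A + β) + (B + (x₁ + x₂))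
    e₂ = solve-∀
    e₃ : ∀ A B α y₁ y₂ → (A + y₁) + (B + (α + y₂)) ≡ (B + α) + (A + (y₁ + y₂))
    e₃ = solve-∀
    e₄ : ∀ B α x₁ x₂ → (B + (α + x₁)) + (B + x₂) ≡ (B + α) + (B + (x₁ + x₂))
    e₄ = solve-∀

  κ-exchange-out : ∀ β β′ x y → β′ ≤ x → y ≤ β →
    κ 0 (β + x) + κ 0 (β′ + y) ≤ κ 0 (β + β′) + κ 0 (x + y)
  κ-exchange-out β β′ x y β′≤x y≤β = ≤-⊓-+-⊓ {p = A + (β + β′)} {B + 0} {A + (x + y)} {B + 0}
    (≤-trans (+-mono-≤ (κ≤in 0 (β + x)) (κ≤in 0 (β′ + y))) (≤-reflexive (e₁ A β β′ x y)))
    (≤-trans (+-mono-≤ (κ≤out 0 (β + x)) (κ≤in 0 (β′ + y)))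
      (≤-trans (+-monoʳ-≤ (B + 0) (+-monoʳ-≤ A (+-monoʳ-≤ β′ y≤β))) (≤-reflexive (e₂ A B β β′))))
    (≤-trans (+-mono-≤ (κ≤out 0 (β + x)) (κ≤in 0 (β′ + y)))
      (+-monoʳ-≤ (B + 0) (+-monoʳ-≤ A (+-monoˡ-≤ y β′≤x))))
    (+-mono-≤ (κ≤out 0 (β + x)) (κ≤out 0 (β′ + y)))
    where
    e₁ : ∀ A β β′ x y → (A + (β + x)) + (A + (β′ + y)) ≡ (A + (β + β′)) + (A + (x + y))
    e₁ = solve-∀
    e₂ : ∀ A B β β′ → (B + 0) + (A + (β′ + β)) ≡ (A + (β + β′)) + (B + 0)
    e₂ = solve-∀

  κ-block : Block → ℕ
  κ-block (xs , ys) = κ (sum xs) (sum ys)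

  κ-total : List Block → ℕ
  κ-total P = sum (map κ-block P)

  κ-total-↭ : ∀ {P Q} → P ↭ Q → κ-total P ≡ κ-total Q
  κ-total-↭ = sum-↭ ∘ map⁺ κ-block

  κ-total-exchange : ∀ {P b₁ b₂ P₂} c K → P ↭ b₁ ∷ b₂ ∷ P₂ →
    κ-block b₁ + κ-block b₂ ≤ K + κ-block c → κ-total P ≤ K + κ-total (c ∷ P₂)
  κ-total-exchange {P} {b₁} {b₂} {P₂} c K P↭ exchange = begin
    κ-total P                                    ≡⟨ κ-total-↭ P↭ ⟩
    κ-block b₁ + (κ-block b₂ + κ-total P₂)       ≡⟨ +-assoc (κ-block b₁) _ _ ⟨
    (κ-block b₁ + κ-block b₂) + κ-total P₂       ≤⟨ +-monoˡ-≤ (κ-total P₂) exchange ⟩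
    (K + κ-block c) + κ-total P₂                 ≡⟨ +-assoc K _ _ ⟩
    K + κ-total (c ∷ P₂)                         ∎
    where open ≤-Reasoning

  -- Period q + 1 of the greedy schedule shuts the q-th in-arc, the q-th out-arc and the
  -- (2T − 1 − q)-th out-arc, counting from 0; nth reads 0 where there is no such arc.
  greedy : ℕ → List ℕ → List ℕ → ℕ
  greedy T as bs = sum (applyUpTo (λ q → κ (nth as q) (nth bs q + nth bs (T + T ∸ suc q))) T)

  greedy-∷∷ : ∀ T α β as bs → length bs ≤ T + T →
    greedy (suc T) (α ∷ as) (β ∷ bs) ≡ κ α β + greedy T as bs
  greedy-∷∷ T α β as bs len≤ = cong₂ _+_ first (cong sum (applyUpTo-cong T rest))
    where
    first : κ α (β + nth (β ∷ bs) (T + suc T)) ≡ κ α β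
    first rewrite +-suc T T | nth-beyond bs (T + T) len≤ | +-identityʳ β = refl
    rest : ∀ q → q < T → κ (nth as q) (nth bs q + nth (β ∷ bs) (T + suc T ∸ suc q))
                       ≡ κ (nth as q) (nth bs q + nth bs (T + T ∸ suc q))
    rest q q<T rewrite +-suc T T | m∸n≡1+m∸1+n (<-≤-trans q<T (m≤m+n T T)) = refl

  greedy-∷∷ʳ : ∀ T β mid β′ → length mid ≡ T + T →
    greedy (suc T) [] (β ∷ mid ∷ʳ β′) ≡ κ 0 (β + β′) + greedy T [] mid
  greedy-∷∷ʳ T β mid β′ len≡ = cong₂ _+_ first (cong sum (applyUpTo-cong T rest))
    where
    first : κ 0 (β + nth (β ∷ mid ∷ʳ β′) (T + suc T)) ≡ κ 0 (β + β′)
    first rewrite +-suc T T | sym len≡ | nth-∷ʳ mid β′ = refl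
    rest : ∀ q → q < T → κ 0 (nth (mid ∷ʳ β′) q + nth (β ∷ mid ∷ʳ β′) (T + suc T ∸ suc q))
                       ≡ κ 0 (nth mid q + nth mid (T + T ∸ suc q))
    rest q q<T
      rewrite +-suc T T | m∸n≡1+m∸1+n (<-≤-trans q<T (m≤m+n T T))
            | nth-++ˡ mid [ β′ ] q (subst (q <_) (sym len≡) (<-≤-trans q<T (m≤m+n T T)))
            | nth-++ˡ mid [ β′ ] (T + T ∸ suc q)
                (subst (T + T ∸ suc q <_) (sym len≡)
                  (subst (_≤ T + T) (m∸n≡1+m∸1+n (<-≤-trans q<T (m≤m+n T T))) (m∸n≤m (T + T) q)))
            = refl

  greedy-++-zeros : ∀ T as bs d → greedy T as (bs ++ replicate d 0) ≡ greedy T as bs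
  greedy-++-zeros T as bs d = cong sum (applyUpTo-cong T λ q _ →
    cong₂ (λ x y → κ (nth as q) (x + y)) (nth-++-zeros bs d q) (nth-++-zeros bs d (T + T ∸ suc q)))

  GreedyBound : ℕ → Set
  GreedyBound T = ∀ {as bs P} → Descending as → Descending bs → length as ≤ length bs →
    length as + length bs ≡ T + T → IsPacking as bs T P → κ-total P ≤ greedy T as bs

  -- The period of the largest in-capacity α may be assumed to contain the largest
  -- out-capacity β: otherwise κ-exchange swaps β with the rest of α's period.
  module Paired {T α β as bs P} (ih : GreedyBound T) (dα : Descending (α ∷ as)) (dβ : Descending (β ∷ bs))
    (len≤ : length as ≤ length bs) (len≡ : length as + length bs ≡ T + T)
    (pk : IsPacking (α ∷ as) (β ∷ bs) (suc T) P) where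

    open IsPacking pk
    open ≤-Reasoning

    das : Descending as
    das = AllPairs.tail dα
    dbs : Descending bs
    dbs = AllPairs.tail dβ

    greedy-step : κ α β + greedy T as bs ≡ greedy (suc T) (α ∷ as) (β ∷ bs)
    greedy-step = sym (greedy-∷∷ T α β as bs (m+n≤o⇒n≤o (length as) (≤-reflexive len≡)))

    same-block : ∀ {la lb P₁} → P ↭ (la , lb) ∷ P₁ → la ↭ [ α ] → lb ↭ [ β ] →
      κ-total P ≤ greedy (suc T) (α ∷ as) (β ∷ bs)
    same-block {la} {lb} {P₁} P↭ la↭ lb↭ = begin
      κ-total P                      ≡⟨ κ-total-↭ P↭ ⟩
      κ (sum la) (sum lb) + κ-total P₁ ≡⟨ cong₂ (λ x y → κ x y + κ-total P₁)
                                            (trans (sum-↭ la↭) (+-identityʳ α)) (trans (sum-↭ lb↭) (+-identityʳ β)) ⟩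
      κ α β + κ-total P₁             ≤⟨ +-monoʳ-≤ (κ α β)
                                          (ih das dbs len≤ len≡
                                            (IsPacking-tail {xs = [ α ]} {ys = [ β ]} pk P↭ la↭ lb↭)) ⟩
      κ α β + greedy T as bs         ≡⟨ greedy-step ⟩
      greedy (suc T) (α ∷ as) (β ∷ bs) ∎

    other-block : ∀ {la lb la′ P₁ ma mb mb′ P₂} → P ↭ (la , lb) ∷ P₁ → la ↭ α ∷ la′ →
      P₁ ↭ (ma , mb) ∷ P₂ → mb ↭ β ∷ mb′ → κ-total P ≤ greedy (suc T) (α ∷ as) (β ∷ bs)
    other-block {la} {lb} {la′} {P₁} {ma} {mb} {mb′} {P₂} P↭ la↭ P₁↭ mb↭ = begin
      κ-total P                      ≤⟨ κ-total-exchange c (κ α β) P↭↭ exchange ⟩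
      κ α β + κ-total (c ∷ P₂)       ≤⟨ +-monoʳ-≤ (κ α β) (ih das dbs len≤ len≡ packing) ⟩
      κ α β + greedy T as bs         ≡⟨ greedy-step ⟩
      greedy (suc T) (α ∷ as) (β ∷ bs) ∎
      where
      c : Block
      c = la′ ++ ma , lb ++ mb′
      P↭↭ : P ↭ (la , lb) ∷ (ma , mb) ∷ P₂
      P↭↭ = ↭-trans P↭ (prep _ P₁↭)
      size₁ : length la′ + length lb ≤ 1
      size₁ = ≤-pred (subst (λ n → n + length lb ≤ 2) (↭-length la↭) (All.head (All-resp-↭ P↭ small)))
      size₂ : length ma + length mb′ ≤ 1
      size₂ = ≤-pred (subst (_≤ 2) (+-suc (length ma) (length mb′))
                (subst (λ n → length ma + n ≤ 2) (↭-length mb↭) (All.head (All.tail (All-resp-↭ P↭↭ small)))))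
      size-c : size c ≤ 2
      size-c rewrite length-++ la′ {ma} | length-++ lb {mb′}
                   | interchange (length la′) (length ma) (length lb) (length mb′) = +-mono-≤ size₁ size₂
      lb≤β : sum lb ≤ β + sum la′
      lb≤β = ≤-trans (sum≤-length≤1 lb (m+n≤o⇒n≤o (length la′) size₁)
                       (AllP.++⁻ˡ lb
                         (All-resp-↭ (concatMap-↭ proj₂ P↭) (All-resp-↭ (↭-sym outs) (Descending-head dβ)))))
                     (m≤m+n β _)
      ma≤α : sum ma ≤ α + sum mb′
      ma≤α = ≤-trans (sum≤-length≤1 ma (m+n≤o⇒m≤o (length ma) size₂)
                       (AllP.++⁻ˡ ma (AllP.++⁻ʳ la
                         (All-resp-↭ (concatMap-↭ proj₁ P↭↭) (All-resp-↭ (↭-sym ins) (Descending-head dα))))))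
                     (m≤m+n α _)
      exchange : κ (sum la) (sum lb) + κ (sum ma) (sum mb) ≤ κ α β + κ (sum (la′ ++ ma)) (sum (lb ++ mb′))
      exchange rewrite sum-↭ la↭ | sum-↭ mb↭ | sum-++ la′ ma | sum-++ lb mb′ =
        κ-exchange α β (sum la′) (sum lb) (sum ma) (sum mb′) lb≤β ma≤α
      packing : IsPacking as bs T (c ∷ P₂)
      packing = IsPacking-merge {xs = [ α ]} {ys = [ β ]} c pk P↭↭ size-c
                  (++⁺ʳ ma la↭) (↭-trans (++⁺ˡ lb mb↭) (shift β lb mb′))

    step : κ-total P ≤ greedy (suc T) (α ∷ as) (β ∷ bs)
    step with block-extract proj₁ P (∈-resp-↭ (↭-sym ins) (here refl))
    ... | (la , lb) , P₁ , la′ , P↭ , la↭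
        with ∈-++⁻ lb (∈-resp-↭ (↭-trans (↭-sym outs) (concatMap-↭ proj₂ P↭)) (here refl))
    ... | inj₂ β∈P₁ with block-extract proj₂ P₁ β∈P₁
    ...   | _ , _ , _ , P₁↭ , mb↭ = other-block P↭ la↭ P₁↭ mb↭
    step | (la , lb) , P₁ , la′ , P↭ , la↭ | inj₁ β∈lb with ∈-extract β∈lb
    ... | lb′ , lb↭ with pair-block la′ lb′ (All.head (All-resp-↭ P↭ small)) la↭ lb↭
    ...   | refl , refl = same-block P↭ la↭ lb↭

  -- Without in-capacities, the largest out-capacity β may be assumed to share its period
  -- with the smallest one β′: otherwise κ-exchange-out swaps β′ with β's partner.
  module Unpaired {T β β′ mid P} (ih : GreedyBound T) (dβ : Descending (β ∷ mid ∷ʳ β′))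
    (len≡ : length mid ≡ T + T) (pk : IsPacking [] (β ∷ mid ∷ʳ β′) (suc T) P) where

    open IsPacking pk
    open ≤-Reasoning

    dmid : Descending mid
    dmid = Descending-∷ʳ⁻ mid (AllPairs.tail dβ)

    pk′ : IsPacking [] (β ∷ β′ ∷ mid) (suc T) P
    pk′ = IsPacking-↭ ↭-refl (prep β (↭-sym (∷↭∷ʳ β′ mid))) pk

    greedy-step : κ 0 (β + β′) + greedy T [] mid ≡ greedy (suc T) [] (β ∷ mid ∷ʳ β′)
    greedy-step = sym (greedy-∷∷ʳ T β mid β′ len≡)

    same-block : ∀ {lb P₁} → P ↭ ([] , lb) ∷ P₁ → lb ↭ β ∷ β′ ∷ [] →
      κ-total P ≤ greedy (suc T) [] (β ∷ mid ∷ʳ β′)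
    same-block {lb} {P₁} P↭ lb↭ = begin
      κ-total P                        ≡⟨ κ-total-↭ P↭ ⟩
      κ 0 (sum lb) + κ-total P₁        ≡⟨ cong (λ y → κ 0 y + κ-total P₁)
                                              (trans (sum-↭ lb↭) (cong (β +_) (+-identityʳ β′))) ⟩
      κ 0 (β + β′) + κ-total P₁        ≤⟨ +-monoʳ-≤ (κ 0 (β + β′))
                                            (ih [] dmid z≤n len≡
                                              (IsPacking-tail {xs = []} {ys = β ∷ β′ ∷ []} pk′ P↭ ↭-refl lb↭)) ⟩
      κ 0 (β + β′) + greedy T [] mid   ≡⟨ greedy-step ⟩
      greedy (suc T) [] (β ∷ mid ∷ʳ β′) ∎

    other-block : ∀ {lb x P₁ mb mb′ P₂} → P ↭ ([] , lb) ∷ P₁ → lb ↭ β ∷ x ∷ [] →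
      P₁ ↭ ([] , mb) ∷ P₂ → mb ↭ β′ ∷ mb′ → κ-total P ≤ greedy (suc T) [] (β ∷ mid ∷ʳ β′)
    other-block {lb} {x} {P₁} {mb} {mb′} {P₂} P↭ lb↭ P₁↭ mb↭ = begin
      κ-total P                        ≤⟨ κ-total-exchange c (κ 0 (β + β′)) P↭↭ exchange ⟩
      κ 0 (β + β′) + κ-total (c ∷ P₂)  ≤⟨ +-monoʳ-≤ (κ 0 (β + β′)) (ih [] dmid z≤n len≡ packing) ⟩
      κ 0 (β + β′) + greedy T [] mid   ≡⟨ greedy-step ⟩
      greedy (suc T) [] (β ∷ mid ∷ʳ β′) ∎
      where
      c : Block
      c = [] , x ∷ mb′
      P↭↭ : P ↭ ([] , lb) ∷ ([] , mb) ∷ P₂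
      P↭↭ = ↭-trans P↭ (prep _ P₁↭)
      size-c : size c ≤ 2
      size-c = subst (_≤ 2) (↭-length mb↭) (All.head (All.tail (All-resp-↭ P↭↭ small)))
      β′≤x : β′ ≤ x
      β′≤x = All.head (All.tail (All-resp-↭ lb↭ (AllP.++⁻ˡ lb
               (All-resp-↭ (concatMap-↭ proj₂ P↭↭) (All-resp-↭ (↭-sym outs) (Descending-last (β ∷ mid) dβ))))))
      mb′≤β : sum mb′ ≤ β
      mb′≤β = sum≤-length≤1 mb′ (≤-pred size-c) (All.tail (All-resp-↭ mb↭ (AllP.++⁻ˡ mb (AllP.++⁻ʳ lb
                (All-resp-↭ (concatMap-↭ proj₂ P↭↭) (All-resp-↭ (↭-sym outs) (Descending-head dβ)))))))
      exchange : κ 0 (sum lb) + κ 0 (sum mb) ≤ κ 0 (β + β′) + κ 0 (x + sum mb′)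
      exchange rewrite sum-↭ lb↭ | +-identityʳ x | sum-↭ mb↭ = κ-exchange-out β β′ x (sum mb′) β′≤x mb′≤β
      packing : IsPacking [] mid T (c ∷ P₂)
      packing = IsPacking-merge {xs = []} {ys = β ∷ β′ ∷ []} c pk′ P↭↭ size-c ↭-refl
                  (↭-trans (++⁺ʳ mb lb↭) (prep β (↭-trans (prep x mb↭) (swap x β′ ↭-refl))))

    others↭ : ∀ {lb x P₁} → P ↭ ([] , lb) ∷ P₁ → lb ↭ β ∷ x ∷ [] → x ∷ concatMap proj₂ P₁ ↭ β′ ∷ mid
    others↭ P↭ lb↭ =
      drop-∷ (↭-trans (++⁺ʳ _ (↭-sym lb↭)) (↭-trans (↭-sym (concatMap-↭ proj₂ P↭)) (IsPacking.outs pk′)))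

    β-block : ∀ {lb P₁} lb′ → P ↭ ([] , lb) ∷ P₁ → lb ↭ β ∷ lb′ → concatMap proj₁ P₁ ≡ [] →
      κ-total P ≤ greedy (suc T) [] (β ∷ mid ∷ʳ β′)
    β-block [] P↭ lb↭ _ =
      ⊥-elim (m+1+n≰m (T + T) (subst (_≤ T + T) (trans (length-++ mid) (cong (_+ 1) len≡))
        (packing-count (IsPacking-tail {xs = []} {ys = [ β ]} pk P↭ ↭-refl lb↭))))
    β-block {P₁ = P₁} (x ∷ []) P↭ lb↭ C₁≡[] with ∈-resp-↭ (↭-sym (others↭ P↭ lb↭)) (here refl)
    ... | here refl = same-block P↭ lb↭
    ... | there β′∈P₁ with block-extract proj₂ P₁ β′∈P₁
    ...   | (ma , mb) , P₂ , mb′ , P₁↭ , mb↭ with no-ins (↭-reflexive C₁≡[]) P₁↭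
    ...     | refl , _ = other-block P↭ lb↭ P₁↭ mb↭
    β-block (_ ∷ _ ∷ _) P↭ lb↭ _ with subst (_≤ 2) (↭-length lb↭) (All.head (All-resp-↭ P↭ small))
    ... | s≤s (s≤s ())

    step : κ-total P ≤ greedy (suc T) [] (β ∷ mid ∷ʳ β′)
    step with block-extract proj₂ P (∈-resp-↭ (↭-sym outs) (here refl))
    ... | (la , lb) , P₁ , lb′ , P↭ , lb↭ with no-ins ins P↭
    ...   | refl , C₁≡[] = β-block lb′ P↭ lb↭ C₁≡[]

  κ-total≤greedy-full : ∀ T → GreedyBound T
  κ-total≤greedy-full zero    {P = []}    _ _ _ _ _ = z≤n
  κ-total≤greedy-full zero    {P = _ ∷ _} _ _ _ _ pk with () ← IsPacking.length≡ pk
  κ-total≤greedy-full (suc T) {[]}    {[]}    _ _ _ () _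
  κ-total≤greedy-full (suc T) {_ ∷ _} {[]}    _ _ () _ _
  κ-total≤greedy-full (suc T) {α ∷ as} {β ∷ bs} dα dβ (s≤s len≤) len≡ pk =
    Paired.step (κ-total≤greedy-full T) dα dβ len≤ halve pk
    where
    halve : length as + length bs ≡ T + T
    halve = suc-injective (begin
      suc (length as + length bs)   ≡⟨ +-suc (length as) (length bs) ⟨
      length as + suc (length bs)   ≡⟨ suc-injective len≡ ⟩
      T + suc T                     ≡⟨ +-suc T T ⟩
      suc (T + T)                   ∎)
      where open ≡-Reasoning
  κ-total≤greedy-full (suc T) {[]} {β ∷ bs} _ dβ _ len≡ pk with initLast bs
  ... | [] with () ← trans (suc-injective len≡) (+-suc T T)
  ... | mid ∷ʳ′ β′ = Unpaired.step (κ-total≤greedy-full T) dβ mid≡ pk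
    where
    mid≡ : length mid ≡ T + T
    mid≡ = suc-injective (begin
      suc (length mid)       ≡⟨ +-comm 1 (length mid) ⟩
      length mid + 1         ≡⟨ length-++ mid ⟨
      length (mid ∷ʳ β′)     ≡⟨ suc-injective len≡ ⟩
      T + suc T              ≡⟨ +-suc T T ⟩
      suc (T + T)            ∎)
      where open ≡-Reasoning

  pad-zeros : ∀ d {as bs T P} → IsPacking as bs T P → length as + length bs + d ≡ T + T →
    Σ (List Block) λ P′ → IsPacking as (bs ++ replicate d 0) T P′ × κ-total P′ ≡ κ-total P
  pad-zeros zero {bs = bs} {P = P} pk _ = P , IsPacking-↭ ↭-refl (↭-reflexive (sym (++-identityʳ bs))) pk , refl
  pad-zeros (suc d) {as} {bs} {T} {P} pk len≡ with small-block P small count<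
    where
    open IsPacking pk
    count< : sum (map size P) < length P + length P
    count< rewrite sym (packing-size pk) | length≡ =
      subst (length as + length bs <_) len≡ (m<m+n (length as + length bs) (s≤s z≤n))
  ... | (la , lb) , P₁ , P↭ , size≤1 with pad-zeros d {bs = bs ∷ʳ 0} pk′ len≡′
    where
    open IsPacking pk
    pk′ : IsPacking as (bs ∷ʳ 0) T ((la , 0 ∷ lb) ∷ P₁)
    pk′ = record
      { length≡ = trans (sym (↭-length P↭)) length≡
      ; small   = subst (_≤ 2) (sym (+-suc (length la) (length lb))) (s≤s size≤1) ∷ All.tail (All-resp-↭ P↭ small)
      ; ins     = ↭-trans (↭-sym (concatMap-↭ proj₁ P↭)) ins
      ; outs    = ↭-trans (prep 0 (↭-trans (↭-sym (concatMap-↭ proj₂ P↭)) outs)) (∷↭∷ʳ 0 bs)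
      }
    len≡′ : length as + length (bs ∷ʳ 0) + d ≡ T + T
    len≡′ = trans (cong (λ n → length as + n + d) (length-++ bs)) (trans (shuffle (length as) (length bs) d) len≡)
      where
      shuffle : ∀ a b d → a + (b + 1) + d ≡ a + b + suc d
      shuffle = solve-∀
  ... | P′ , pk″ , κ≡ =
    P′ , subst (λ cs → IsPacking as cs T P′) (List.++-assoc bs [ 0 ] (replicate d 0)) pk″ ,
    trans κ≡ (sym (κ-total-↭ P↭))

  κ-total≤greedy : ∀ {T as bs P} → Descending as → Descending bs → length as ≤ length bs →
    length as + length bs ≤ T + T → IsPacking as bs T P → κ-total P ≤ greedy T as bs
  κ-total≤greedy {T} {as} {bs} {P} das dbs len≤ len≤2T pk = bound (pad-zeros d pk (m+[n∸m]≡n len≤2T))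
    where
    open ≤-Reasoning
    d : ℕ
    d = T + T ∸ (length as + length bs)
    len≡ : length as + length (bs ++ replicate d 0) ≡ T + T
    len≡ rewrite length-++ bs {replicate d 0} | length-replicate d {0} =
      trans (sym (+-assoc (length as) (length bs) d)) (m+[n∸m]≡n len≤2T)
    bound : Σ (List Block) (λ P′ → IsPacking as (bs ++ replicate d 0) T P′ × κ-total P′ ≡ κ-total P) →
      κ-total P ≤ greedy T as bs
    bound (P′ , pk′ , κ≡) = begin
      κ-total P                          ≡⟨ κ≡ ⟨
      κ-total P′                         ≤⟨ κ-total≤greedy-full T das (Descending-++-zeros d dbs)
                                                (≤-trans len≤ (length-++-≤ˡ bs)) len≡ pk′ ⟩
      greedy T as (bs ++ replicate d 0)  ≡⟨ greedy-++-zeros T as bs d ⟩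
      greedy T as bs                     ∎

module Instance (m : ℕ) (tl hd : Fin m → Fin 3) (u : Fin m → ℕ) (J : Fin m → Bool) (T : ℕ)
  (arcs : ∀ e → (tl e ≡ nS × hd e ≡ nV) ⊎ (tl e ≡ nV × hd e ≡ nT))
  (r s : ℕ) (a : Fin r → Fin m) (b : Fin s → Fin m)
  (a-inj : ∀ i j → a i ≡ a j → i ≡ j)
  (a-in : ∀ i → J (a i) ≡ true × hd (a i) ≡ nV)
  (a-onto : ∀ e → J e ≡ true → hd e ≡ nV → Σ (Fin r) (λ i → a i ≡ e))
  (b-inj : ∀ i j → b i ≡ b j → i ≡ j)
  (b-out : ∀ j → J (b j) ≡ true × tl (b j) ≡ nV)
  (b-onto : ∀ e → J e ≡ true → tl e ≡ nV → Σ (Fin s) (λ j → b j ≡ e)) where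

  open ThreeNode m tl hd u arcs

  in-job out-job : Fin m → Bool
  in-job  e = J e ∧ ⌊ hd e ≟ᶠ nV ⌋
  out-job e = J e ∧ ⌊ tl e ≟ᶠ nV ⌋

  sum-in-jobs : ∀ g → sumFin (λ e → if in-job e then g e else 0) ≡ sumFin (g ∘ a)
  sum-in-jobs = sumFin-reindex a in-job a-inj a-in-job onto
    where
    a-in-job : ∀ i → in-job (a i) ≡ true
    a-in-job i rewrite proj₁ (a-in i) | proj₂ (a-in i) = refl
    onto : ∀ e → in-job e ≡ true → Σ (Fin r) (λ i → a i ≡ e)
    onto e _ with J e in Je | hd e ≟ᶠ nV
    onto e _  | true  | yes hd≡ = a-onto e Je hd≡
    onto e () | true  | no _
    onto e () | false | _

  sum-out-jobs : ∀ g → sumFin (λ e → if out-job e then g e else 0) ≡ sumFin (g ∘ b)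
  sum-out-jobs = sumFin-reindex b out-job b-inj b-out-job onto
    where
    b-out-job : ∀ j → out-job (b j) ≡ true
    b-out-job j rewrite proj₁ (b-out j) | proj₂ (b-out j) = refl
    onto : ∀ e → out-job e ≡ true → Σ (Fin s) (λ j → b j ≡ e)
    onto e _ with J e in Je | tl e ≟ᶠ nV
    onto e _  | true  | yes tl≡ = b-onto e Je tl≡
    onto e () | true  | no _
    onto e () | false | _

  shutIn shutOut : (Fin m → ℕ) → ℕ → ℕ
  shutIn  τ p = sumFin (λ i → if ⌊ τ (a i) ≟ p ⌋ then u (a i) else 0)
  shutOut τ p = sumFin (λ j → if ⌊ τ (b j) ≟ p ⌋ then u (b j) else 0)

  A B : ℕ
  A = inflow N u nV
  B = outflow N u nV

  open Exchange A B public

  capAt+shut≡u : ∀ (end : Fin m → Fin 3) τ p →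
    sumFin (λ e → if ⌊ end e ≟ᶠ nV ⌋ then capAt N J τ p e else 0)
      + sumFin (λ e → if J e ∧ ⌊ end e ≟ᶠ nV ⌋ then (if ⌊ τ e ≟ p ⌋ then u e else 0) else 0)
    ≡ sumFin (λ e → if ⌊ end e ≟ᶠ nV ⌋ then u e else 0)
  capAt+shut≡u end τ p = trans (sym (sumFin-+ {m} _ _)) (sumFin-cong split)
    where
    split : ∀ e → (if ⌊ end e ≟ᶠ nV ⌋ then capAt N J τ p e else 0)
                + (if J e ∧ ⌊ end e ≟ᶠ nV ⌋ then (if ⌊ τ e ≟ p ⌋ then u e else 0) else 0)
                ≡ (if ⌊ end e ≟ᶠ nV ⌋ then u e else 0)
    split e with ⌊ end e ≟ᶠ nV ⌋ | J e | ⌊ τ e ≟ p ⌋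
    ... | true  | true  | true  = refl
    ... | true  | true  | false = +-identityʳ _
    ... | true  | false | _     = +-identityʳ _
    ... | false | true  | _     = refl
    ... | false | false | _     = refl

  inflow+shutIn : ∀ τ p → inflow N (capAt N J τ p) nV + shutIn τ p ≡ A
  inflow+shutIn τ p = trans
    (cong (inflow N (capAt N J τ p) nV +_) (sym (sum-in-jobs (λ e → if ⌊ τ e ≟ p ⌋ then u e else 0))))
    (capAt+shut≡u hd τ p)

  outflow+shutOut : ∀ τ p → outflow N (capAt N J τ p) nV + shutOut τ p ≡ B
  outflow+shutOut τ p = trans
    (cong (outflow N (capAt N J τ p) nV +_) (sym (sum-out-jobs (λ e → if ⌊ τ e ≟ p ⌋ then u e else 0))))
    (capAt+shut≡u tl τ p)

  throughput+shut≡κ : ∀ τ p →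
    throughput (capAt N J τ p) + (shutIn τ p + shutOut τ p) ≡ κ (shutIn τ p) (shutOut τ p)
  throughput+shut≡κ τ p = trans (+-distribʳ-⊓ (X + Y) I O)
    (cong₂ _⊓_ (trans (sym (+-assoc I X Y)) (cong (_+ Y) (inflow+shutIn τ p)))
               (trans (cong (O +_) (+-comm X Y))
                      (trans (sym (+-assoc O Y X)) (cong (_+ X) (outflow+shutOut τ p)))))
    where
    I O X Y : ℕ
    I = inflow N (capAt N J τ p) nV
    O = outflow N (capAt N J τ p) nV
    X = shutIn τ p
    Y = shutOut τ p

  block : (Fin m → ℕ) → ℕ → Block
  block τ p = fibre (τ ∘ a) (u ∘ a) p , fibre (τ ∘ b) (u ∘ b) p

  blocks : (Fin m → ℕ) → List Block
  blocks τ = applyUpTo (block τ ∘ suc) T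

  as bs : List ℕ
  as = tabulate (u ∘ a)
  bs = tabulate (u ∘ b)

  κ-block-block : ∀ τ p → κ-block (block τ p) ≡ κ (shutIn τ p) (shutOut τ p)
  κ-block-block τ p = cong₂ κ (sum-fibre (τ ∘ a) (u ∘ a) p) (sum-fibre (τ ∘ b) (u ∘ b) p)

  numShut≡size : ∀ τ p → numShut N J τ p ≡ size (block τ p)
  numShut≡size τ p = begin
    numShut N J τ p
      ≡⟨ sumFin-cong split ⟩
    sumFin (λ e → (if in-job e then shut-now e else 0) + (if out-job e then shut-now e else 0))
      ≡⟨ sumFin-+ {m} _ _ ⟩
    sumFin (λ e → if in-job e then shut-now e else 0) + sumFin (λ e → if out-job e then shut-now e else 0)
      ≡⟨ cong₂ _+_ (sum-in-jobs shut-now) (sum-out-jobs shut-now) ⟩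
    sumFin (shut-now ∘ a) + sumFin (shut-now ∘ b)
      ≡⟨ cong₂ _+_ (length-fibre (τ ∘ a) (u ∘ a) p) (length-fibre (τ ∘ b) (u ∘ b) p) ⟨
    size (block τ p) ∎
    where
    open ≡-Reasoning
    shut-now : Fin m → ℕ
    shut-now e = if ⌊ τ e ≟ p ⌋ then 1 else 0
    split : ∀ e → (if J e ∧ ⌊ τ e ≟ p ⌋ then 1 else 0)
                ≡ (if in-job e then shut-now e else 0) + (if out-job e then shut-now e else 0)
    split e with arcs e
    ... | inj₁ (tl≡ , hd≡) rewrite tl≡ | hd≡ with J e
    ...   | true  = sym (+-identityʳ _)
    ...   | false = refl
    split e | inj₂ (tl≡ , hd≡) rewrite tl≡ | hd≡ with J e
    ...   | true  = refl
    ...   | false = refl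

  module _ {τ} (τ-feasible : Feasible N J T 2 τ) where

    private
      period∈ : ∀ e → J e ≡ true → 1 ≤ τ e × τ e ≤ T
      period∈ = proj₁ τ-feasible
      a∈ : ∀ i → 1 ≤ τ (a i) × τ (a i) ≤ T
      a∈ i = period∈ (a i) (proj₁ (a-in i))
      b∈ : ∀ j → 1 ≤ τ (b j) × τ (b j) ≤ T
      b∈ j = period∈ (b j) (proj₁ (b-out j))

    blocks-packing : IsPacking as bs T (blocks τ)
    blocks-packing = record
      { length≡ = length-applyUpTo (block τ ∘ suc) T
      ; small   = AllP.applyUpTo⁺₁ (block τ ∘ suc) T λ {q} q<T →
                    subst (_≤ 2) (numShut≡size τ (suc q)) (proj₂ τ-feasible (suc q) (s≤s z≤n) q<T)
      ; ins     = subst (_↭ as) (cong concat (sym (map-applyUpTo (block τ ∘ suc) proj₁ T)))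
                    (concat-fibres-from-1 T (τ ∘ a) (u ∘ a) a∈)
      ; outs    = subst (_↭ bs) (cong concat (sym (map-applyUpTo (block τ ∘ suc) proj₂ T)))
                    (concat-fibres-from-1 T (τ ∘ b) (u ∘ b) b∈)
      }

    weight+shut≡κ-total : weight J T τ + (sum as + sum bs) ≡ κ-total (blocks τ)
    weight+shut≡κ-total = begin
      weight J T τ + (sum as + sum bs)
        ≡⟨ cong (weight J T τ +_) (cong₂ _+_ (sum-periods-fibres T (τ ∘ a) (u ∘ a) a∈)
                                              (sum-periods-fibres T (τ ∘ b) (u ∘ b) b∈)) ⟨
      weight J T τ + (sum (applyUpTo (shutIn τ ∘ suc) T) + sum (applyUpTo (shutOut τ ∘ suc) T))
        ≡⟨ cong (weight J T τ +_) (sum-applyUpTo-+ (shutIn τ ∘ suc) (shutOut τ ∘ suc) T) ⟨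
      weight J T τ + sum (applyUpTo (λ q → shutIn τ (suc q) + shutOut τ (suc q)) T)
        ≡⟨ sum-applyUpTo-+ (λ q → throughput (capAt N J τ (suc q))) _ T ⟨
      sum (applyUpTo (λ q → throughput (capAt N J τ (suc q)) + (shutIn τ (suc q) + shutOut τ (suc q))) T)
        ≡⟨ cong sum (applyUpTo-cong T λ q _ →
             trans (throughput+shut≡κ τ (suc q)) (sym (κ-block-block τ (suc q)))) ⟩
      sum (applyUpTo (κ-block ∘ block τ ∘ suc) T)
        ≡⟨ cong sum (map-applyUpTo (block τ ∘ suc) κ-block T) ⟨
      κ-total (blocks τ) ∎
      where open ≡-Reasoning

  blocks≤greedy : r ≤ s → r + s ≤ T + T →
    (∀ (i i' : Fin r) → toℕ i ≤ toℕ i' → u (a i') ≤ u (a i)) →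
    (∀ (j j' : Fin s) → toℕ j ≤ toℕ j' → u (b j') ≤ u (b j)) →
    ∀ {τ} → Feasible N J T 2 τ → κ-total (blocks τ) ≤ greedy T as bs
  blocks≤greedy r≤s r+s≤2T a-sorted b-sorted τ-feasible =
    κ-total≤greedy (tabulate-descending a-sorted) (tabulate-descending b-sorted)
      (subst₂ _≤_ r≡|as| s≡|bs| r≤s) (subst₂ (λ x y → x + y ≤ T + T) r≡|as| s≡|bs| r+s≤2T)
      (blocks-packing τ-feasible)
    where
    r≡|as| : r ≡ length as
    r≡|as| = sym (length-tabulate (u ∘ a))
    s≡|bs| : s ≡ length bs
    s≡|bs| = sym (length-tabulate (u ∘ b))

  module Greedy (r≤s : r ≤ s) (r+s≤2T : r + s ≤ T + T) (σ : Fin m → ℕ)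
    (σ-a : ∀ i → σ (a i) ≡ suc (toℕ i))
    (σ-b-low : ∀ j → toℕ j < T → σ (b j) ≡ suc (toℕ j))
    (σ-b-high : ∀ j → T ≤ toℕ j → σ (b j) ≡ T + T ∸ toℕ j) where

    private
      s≤2T : s ≤ T + T
      s≤2T = m+n≤o⇒n≤o r r+s≤2T
      j≤2T : ∀ (j : Fin s) → toℕ j ≤ T + T
      j≤2T j = ≤-trans (<⇒≤ (Fin.toℕ<n j)) s≤2T

    in-period-sum : ∀ (v : Fin r → ℕ) q →
      sumFin (λ i → if ⌊ σ (a i) ≟ suc q ⌋ then v i else 0) ≡ nth (tabulate v) q
    in-period-sum v q = trans (sumFin-cong λ i → cong (if_then v i else 0)
                            (trans (cong (λ p → ⌊ p ≟ suc q ⌋) (σ-a i)) (⌊suc≟suc⌋ (toℕ i) q)))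
                          (sumFin-select v q)

    out-period-split : ∀ (v : Fin s → ℕ) q → q < T → ∀ j →
      (if ⌊ σ (b j) ≟ suc q ⌋ then v j else 0)
      ≡ (if ⌊ toℕ j ≟ q ⌋ then v j else 0) + (if ⌊ toℕ j ≟ T + T ∸ suc q ⌋ then v j else 0)
    out-period-split v q q<T j with toℕ j <? T
    ... | yes j<T rewrite σ-b-low j j<T | ⌊suc≟suc⌋ (toℕ j) q
                        | ⌊≟⌋-false (<⇒≢ (<-≤-trans j<T (m+n≤o⇒m≤o∸n T (+-monoʳ-≤ T q<T)))) =
      sym (+-identityʳ _)
    ... | no j≮T rewrite σ-b-high j (≮⇒≥ j≮T) | ⌊≟⌋-false (≢-sym (<⇒≢ (<-≤-trans q<T (≮⇒≥ j≮T))))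
                       | ⌊≟⌋-⇔ {T + T ∸ toℕ j} {suc q} {toℕ j} {T + T ∸ suc q}
                           (λ eq → trans (sym (m∸[m∸n]≡n (j≤2T j))) (cong (T + T ∸_) eq))
                           (λ eq → trans (cong (T + T ∸_) eq) (m∸[m∸n]≡n (<-≤-trans q<T (m≤m+n T T)))) = refl

    out-period-sum : ∀ (v : Fin s → ℕ) q → q < T →
      sumFin (λ j → if ⌊ σ (b j) ≟ suc q ⌋ then v j else 0)
      ≡ nth (tabulate v) q + nth (tabulate v) (T + T ∸ suc q)
    out-period-sum v q q<T = trans (sumFin-cong (out-period-split v q q<T))
      (trans (sumFin-+ (λ j → if ⌊ toℕ j ≟ q ⌋ then v j else 0)
                       (λ j → if ⌊ toℕ j ≟ T + T ∸ suc q ⌋ then v j else 0))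
             (cong₂ _+_ (sumFin-select v q) (sumFin-select v (T + T ∸ suc q))))

    feasible : Feasible N J T 2 σ
    feasible = in-range , at-most-two
      where
      r≤T : r ≤ T
      r≤T with r ≤? T
      ... | yes r≤T = r≤T
      ... | no  r≰T = ⊥-elim (<⇒≱ (+-mono-< (≰⇒> r≰T) (≰⇒> r≰T)) (≤-trans (+-monoʳ-≤ r r≤s) r+s≤2T))
      in-range : ∀ e → J e ≡ true → 1 ≤ σ e × σ e ≤ T
      in-range e Je with arcs e
      ... | inj₁ (_ , hd≡) with i , refl ← a-onto e Je hd≡ rewrite σ-a i =
        s≤s z≤n , ≤-trans (Fin.toℕ<n i) r≤T
      in-range e Je | inj₂ (tl≡ , _) with j , refl ← b-onto e Je tl≡ with toℕ j <? T
      ... | yes j<T rewrite σ-b-low j j<T = s≤s z≤n , j<T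
      ... | no  j≮T rewrite σ-b-high j (≮⇒≥ j≮T) =
        m<n⇒0<n∸m (<-≤-trans (Fin.toℕ<n j) s≤2T) ,
        ≤-trans (∸-monoʳ-≤ (T + T) (≮⇒≥ j≮T)) (≤-reflexive (m+n∸n≡m T T))
      ones≤1 : ∀ {n} q → nth (tabulate {n = n} (λ _ → 1)) q ≤ 1
      ones≤1 {n} q = nth-≤ (tabulate {n = n} (λ _ → 1)) q (AllP.tabulate⁺ λ _ → ≤-refl)
      ones-beyond : ∀ {n} q → n ≤ q → nth (tabulate {n = n} (λ _ → 1)) q ≡ 0
      ones-beyond {n} q n≤q =
        nth-beyond (tabulate {n = n} (λ _ → 1)) q (subst (_≤ q) (sym (length-tabulate (λ _ → 1))) n≤q)
      at-most-two : ∀ p → 1 ≤ p → p ≤ T → numShut N J σ p ≤ 2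
      at-most-two (suc q) _ q<T
        rewrite numShut≡size σ (suc q)
              | length-fibre (σ ∘ a) (u ∘ a) (suc q) | length-fibre (σ ∘ b) (u ∘ b) (suc q)
              | in-period-sum (λ _ → 1) q | out-period-sum (λ _ → 1) q q<T with q <? r
      ... | yes q<r rewrite ones-beyond {s} (T + T ∸ suc q) (m+n≤o⇒m≤o∸n s (subst (_≤ T + T) (+-comm (suc q) s)
                                  (≤-trans (+-monoˡ-≤ s q<r) r+s≤2T))) =
        +-mono-≤ (ones≤1 {r} q) (+-mono-≤ (ones≤1 {s} q) (z≤n {0}))
      ... | no  q≮r rewrite ones-beyond {r} q (≮⇒≥ q≮r) = +-mono-≤ (ones≤1 {s} q) (ones≤1 {s} (T + T ∸ suc q))

    κ-total≡greedy : κ-total (blocks σ) ≡ greedy T as bs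
    κ-total≡greedy = trans (cong sum (map-applyUpTo (block σ ∘ suc) κ-block T))
      (cong sum (applyUpTo-cong T λ q q<T → trans (κ-block-block σ (suc q))
        (cong₂ κ (in-period-sum (u ∘ a) q) (out-period-sum (u ∘ b) q q<T))))

-- Conditions (i)–(iii) of the statement on the out-arcs mean that b j is shut in period
-- j + 1 if j < T and in period 2T − j otherwise (counting j from 0).
module OutSchedule (T r s : ℕ) (f : Fin s → ℕ) (r+s≤2T : r + s ≤ 2 * T)
  (first : ∀ (j : Fin s) → toℕ j < r → f j ≡ suc (toℕ j))
  (alone : ∀ (j : Fin s) → r ≤ toℕ j → suc (toℕ j) ≤ T ⊓ (2 * T ∸ s) → f j ≡ suc (toℕ j))
  (paired : T < s →
     (∀ (j : Fin s) → 2 * T ∸ s < suc (toℕ j) → suc (toℕ j) ≤ T → f j ≡ suc (toℕ j))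
     × (∀ (p : ℕ) (j : Fin s) → 2 * T ∸ s < p → p ≤ T → suc (toℕ j) ≡ 2 * T + 1 ∸ p → f j ≡ p)) where

  s≤2T : s ≤ 2 * T
  s≤2T = m+n≤o⇒n≤o r r+s≤2T

  low : ∀ j → toℕ j < T → f j ≡ suc (toℕ j)
  low j j<T with toℕ j <? r
  ... | yes j<r = first j j<r
  ... | no  j≮r with suc (toℕ j) ≤? 2 * T ∸ s
  ...   | yes j<2T∸s = alone j (≮⇒≥ j≮r) (⊓-glb j<T j<2T∸s)
  ...   | no  j≮2T∸s = proj₁ (paired T<s) j (≰⇒> j≮2T∸s) j<T
    where
    T<s : T < s
    T<s = ≰⇒> λ s≤T → j≮2T∸s (≤-trans j<T
            (m+n≤o⇒m≤o∸n T (subst (T + s ≤_) (sym (2*n≡n+n T)) (+-monoʳ-≤ T s≤T))))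

  high : ∀ j → T ≤ toℕ j → f j ≡ T + T ∸ toℕ j
  high j T≤j = subst (λ n → f j ≡ n ∸ toℕ j) (2*n≡n+n T)
    (proj₂ (paired (≤-<-trans T≤j (Fin.toℕ<n j))) (2 * T ∸ toℕ j) j
      (∸-monoʳ-< (Fin.toℕ<n j) s≤2T)
      (≤-trans (∸-monoʳ-≤ (2 * T) T≤j) (≤-reflexive (trans (cong (_∸ T) (2*n≡n+n T)) (m+n∸n≡m T T))))
      (sym (trans (+-∸-comm 1 (m∸n≤m (2 * T) (toℕ j)))
                  (trans (cong (_+ 1) (m∸[m∸n]≡n j≤2T)) (+-comm (toℕ j) 1)))))
    where
    j≤2T : toℕ j ≤ 2 * T
    j≤2T = ≤-trans (<⇒≤ (Fin.toℕ<n j)) s≤2T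

proposition2 : (m : ℕ) (tl hd : Fin m → Fin 3) (u : Fin m → ℕ) (J : Fin m → Bool) (T : ℕ) →
    1 ≤ T →
    (∀ e → (tl e ≡ nS × hd e ≡ nV) ⊎ (tl e ≡ nV × hd e ≡ nT)) →
    (r s : ℕ) (a : Fin r → Fin m) (b : Fin s → Fin m) →
    (∀ i j → a i ≡ a j → i ≡ j) →
    (∀ i → J (a i) ≡ true × hd (a i) ≡ nV) →
    (∀ e → J e ≡ true → hd e ≡ nV → Σ (Fin r) (λ i → a i ≡ e)) →
    (∀ i j → b i ≡ b j → i ≡ j) →
    (∀ j → J (b j) ≡ true × tl (b j) ≡ nV) →
    (∀ e → J e ≡ true → tl e ≡ nV → Σ (Fin s) (λ j → b j ≡ e)) →
    r ≤ s →
    (∀ (i i' : Fin r) → toℕ i ≤ toℕ i' → u (a i') ≤ u (a i)) →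
    (∀ (j j' : Fin s) → toℕ j ≤ toℕ j' → u (b j') ≤ u (b j)) →
    r + s ≤ 2 * T →
    (σ : Fin m → ℕ) →
    (∀ (i : Fin r) → σ (a i) ≡ suc (toℕ i)) →
    (∀ (j : Fin s) → toℕ j < r → σ (b j) ≡ suc (toℕ j)) →
    (∀ (j : Fin s) → r ≤ toℕ j → suc (toℕ j) ≤ T ⊓ (2 * T ∸ s) →
       σ (b j) ≡ suc (toℕ j)) →
    (T < s →
       (∀ (j : Fin s) → 2 * T ∸ s < suc (toℕ j) → suc (toℕ j) ≤ T →
          σ (b j) ≡ suc (toℕ j))
       × (∀ (p : ℕ) (j : Fin s) → 2 * T ∸ s < p → p ≤ T →
          suc (toℕ j) ≡ 2 * T + 1 ∸ p → σ (b j) ≡ p)) →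
    Optimal (net3 m tl hd u) J T 2 σ
proposition2 m tl hd u J T _ arcs r s a b a-inj a-in a-onto b-inj b-out b-onto
             r≤s a-sorted b-sorted r+s≤2T σ σ-a σ-b₁ σ-b₂ σ-b₃ =
  maximal⇒optimal feasible maximal
  where
  r+s≤T+T : r + s ≤ T + T
  r+s≤T+T = subst (r + s ≤_) (2*n≡n+n T) r+s≤2T
  open ThreeNode m tl hd u arcs
  open Instance m tl hd u J T arcs r s a b a-inj a-in a-onto b-inj b-out b-onto
  open OutSchedule T r s (σ ∘ b) r+s≤2T σ-b₁ σ-b₂ σ-b₃
  open Greedy r≤s r+s≤T+T σ σ-a low high
  open ≤-Reasoning
  maximal : ∀ τ → Feasible N J T 2 τ → weight J T τ ≤ weight J T σ
  maximal τ τ-feasible = +-cancelʳ-≤ (sum as + sum bs) _ _ (begin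
    weight J T τ + (sum as + sum bs)  ≡⟨ weight+shut≡κ-total τ-feasible ⟩
    κ-total (blocks τ)                ≤⟨ blocks≤greedy r≤s r+s≤T+T a-sorted b-sorted τ-feasible ⟩
    greedy T as bs                    ≡⟨ κ-total≡greedy ⟨
    κ-total (blocks σ)                ≡⟨ weight+shut≡κ-total feasible ⟨
    weight J T σ + (sum as + sum bs)  ∎)
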